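{- Let $\mathcal{C}=\{c_1,c_2,\ldots,c_r\}$ be a set of colors and let $f$ be a mapping from $\mathcal{C}$ to the set of non-negative integers such that $\sum_{i=1}^{r} f(c_i)=n-m$. Let $(G,\mathcal{C},\mathit{color})$ be an edge-colored graph of order $n$. Then $G$ has a spanning forest with exactly $m$ components and exactly $f(c_i)$ edges of color $c_i$ for each $i$ if and only if \[ \omega(G-E_R(G)) \le m+\sum_{c\in R} f(c) \quad \text{for every } R\subseteq \mathcal{C}. \]
   Context: An edge-colored graph $(G,\mathcal{C},\mathit{color})$ is a finite simple undirected graph $G$ together with a map $\mathit{color}:E(G)\to\mathcal{C}$. For $R\subseteq\mathcal{C}$, $E_R(G)=\{e\in E(G) : \mathit{color}(e)\in R\}$, and $G-E_R(G)$ denotes the graph $(V(G),E(G)\setminus E_R(G))$. $\omega(H)$ denotes the number of connected components of a graph $H$. -}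

module Defs where

open import Data.Nat using (ℕ; zero; suc; _+_; _<_; _≤_)
open import Data.Nat.Properties using (_<?_)
open import Data.Fin using (Fin; zero; suc; toℕ; inject₁; fromℕ)
open import Data.Fin.Properties using (_≟_)
open import Data.Bool using (Bool; true; false; _∧_; not; if_then_else_)
open import Data.Product using (Σ; _×_)
open import Relation.Nullary using (¬_; Dec; yes; no)
open import Relation.Binary.PropositionalEquality using (_≡_)
open import Function.Definitions using (Injective; Surjective)
open import Function.Bundles using (_⇔_)

∑ : ∀ {r : ℕ} → (Fin r → ℕ) → ℕ
∑ {zero}  g = 0
∑ {suc r} g = g zero + ∑ (λ i → g (suc i))

Adj : ℕ → Set
Adj n = Fin n → Fin n → Bool

record Graph (n : ℕ) : Set where
  field
    adj    : Adj n
    sym    : ∀ u v → adj u v ≡ adj v u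
    irrefl : ∀ v → adj v v ≡ false
open Graph public

SpanningSubgraph : ∀ {n} → Graph n → Graph n → Set
SpanningSubgraph {n} H G = ∀ (u v : Fin n) → adj H u v ≡ true → adj G u v ≡ true

data Walk {n : ℕ} (A : Adj n) : Fin n → Fin n → Set where
  here : ∀ {v} → Walk A v v
  step : ∀ {u w v} → A u w ≡ true → Walk A w v → Walk A u v

HasComponents : ∀ {n} → Adj n → ℕ → Set
HasComponents {n} A k =
  Σ (Fin n → Fin k) λ c →
    Surjective _≡_ _≡_ c × (∀ u v → (c u ≡ c v) ⇔ Walk A u v)

ω≤ : ∀ {n} → Adj n → ℕ → Set
ω≤ A b = ∀ k → HasComponents A k → k ≤ b

Cycle : ∀ {n} → Adj n → Set
Cycle {n} A =
  Σ ℕ λ k → Σ (Fin (3 + k) → Fin n) λ vs →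
    Injective _≡_ _≡_ vs ×
    (∀ (i : Fin (2 + k)) → A (vs (inject₁ i)) (vs (suc i)) ≡ true) ×
    A (vs (fromℕ (2 + k))) (vs zero) ≡ true

Forest : ∀ {n} → Graph n → Set
Forest F = ¬ Cycle (adj F)

-- Colors are Fin r; an edge coloring is a function on vertex pairs
-- (only its values on edges matter).
Coloring : ℕ → ℕ → Set
Coloring n r = Fin n → Fin n → Fin r

isColor : ∀ {r} → Fin r → Fin r → Bool
isColor a b with a ≟ b
... | yes _ = true
... | no  _ = false

lt : ∀ {n} → Fin n → Fin n → Bool
lt u v with toℕ u <? toℕ v
... | yes _ = true
... | no  _ = false

colorCount : ∀ {n r} → Graph n → Coloring n r → Fin r → ℕ
colorCount H col c =
  ∑ (λ u → ∑ (λ v →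
      if lt u v ∧ adj H u v ∧ isColor (col u v) c then 1 else 0))

removeColors : ∀ {n r} → Graph n → Coloring n r → (Fin r → Bool) → Adj n
removeColors G col R u v = adj G u v ∧ not (R (col u v))

∑in : ∀ {r} → (Fin r → Bool) → (Fin r → ℕ) → ℕ
∑in R f = ∑ (λ c → if R c then f c else 0)

-- A spanning forest with m components has n − m independent edges in the graphic matroid of G,
-- whose rank is n minus the number of blocks of the partition obtained by merging endpoints edge
-- by edge. The forest edges of colors outside R stay independent in G − E_R(G), so that graph has
-- at most n − ∑_{c ∉ R} f(c) = m + ∑_{c ∈ R} f(c) components.
-- Conversely, take f(c) "slots" for each color c, each slot carrying all edges of color c. The
-- hypothesis says that every set I of slots spans a subgraph of rank at least |I|; by Rado's
-- theorem, proved by his exchange argument from the submodularity of the rank, the slots have an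
-- independent transversal, and its n − m edges form the required forest.

module Submission where

open import Defs hiding (sym)

open import Data.Bool using (Bool; true; false; _∧_; _∨_; not; if_then_else_)
open import Data.Bool.Properties using (∨-comm; ∨-zeroʳ; ∧-zeroʳ; not-involutive) renaming (_≟_ to _≟ᵇ_)
open import Data.Empty using (⊥; ⊥-elim)
open import Data.Fin using (Fin; zero; suc; toℕ; inject₁; fromℕ; punchIn; punchOut)
open import Data.Fin.Properties
  using (_≟_; any?; suc-injective; toℕ-injective; fromℕ≢inject₁; injective⇒≤;
         punchIn-punchOut; punchOut-cong; punchOut-injective; punchOut-punchIn; punchInᵢ≢i)
open import Data.List using (List; []; _∷_; _++_; length; [_]; filter)
import Data.List.Membership.DecPropositional as DecMembership
open import Data.List.Membership.Propositional using (_∈_; _∉_; lose)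
open import Data.List.Membership.Propositional.Properties using (∈-++⁺ˡ; ∈-++⁺ʳ; ∈-++⁻; ∈-filter⁺)
open import Data.List.Properties using (length-++; ++-assoc; filter-notAll)
open import Data.List.Relation.Binary.Subset.Propositional using (_⊆_)
open import Data.List.Relation.Binary.Subset.Propositional.Properties using (⊆-reflexive; ⊆-trans; xs⊆x∷xs; ∷⁺ʳ)
import Data.List.Relation.Unary.All as All
open import Data.List.Relation.Unary.All using ([])
open import Data.List.Relation.Unary.AllPairs using ([]; _∷_)
open import Data.List.Relation.Unary.Any using (here; there)
open import Data.List.Relation.Unary.Unique.Propositional using (Unique)
open import Data.List.Relation.Unary.Unique.Propositional.Properties using (++⁺)
open import Data.Nat using (ℕ; zero; suc; _+_; _≤_; _<_; z≤n; s≤s)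
open import Data.Nat.Properties
  using (+-0-commutativeMonoid; _<?_; _≤?_; <-cmp; module ≤-Reasoning;
         ≤-refl; ≤-reflexive; ≤-trans; ≤-antisym; ≤-pred; n≤1+n; m≤m+n; m≤n+m; 1+n≰n; ≰⇒>; <-irrefl; <-asym;
         +-assoc; +-identityʳ; +-mono-≤; +-monoʳ-≤; +-mono-<-≤; +-mono-≤-<; +-cancelʳ-≤; +-cancelˡ-≡)
open import Data.Nat.Tactic.RingSolver using (solve-∀)
open import Data.Product using (Σ; ∃; _×_; _,_; proj₁; proj₂; map₂)
open import Data.Product.Properties using (≡-dec)
open import Data.Sum using (_⊎_; inj₁; inj₂)
open import Data.Unit using (⊤; tt)
import Data.Vec.Functional as Vec
open import Data.Vec.Functional.Properties using (∷-cong; updateAt-updates; updateAt-minimal)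
open import Function using (_∘_; flip)
open import Function.Bundles using (_⇔_; mk⇔; Equivalence)
open import Relation.Binary.Definitions using (tri<; tri≈; tri>)
open import Relation.Binary.PropositionalEquality hiding ([_])
open import Relation.Nullary using (¬_; Dec; yes; no; does; _×-dec_)

open import Algebra.Properties.CommutativeMonoid.Sum +-0-commutativeMonoid as Sum using (sum)

⟦_⟧ : Bool → ℕ
⟦ b ⟧ = if b then 1 else 0

∧-true⁻ : ∀ {a b} → a ∧ b ≡ true → a ≡ true × b ≡ true
∧-true⁻ {true} b≡true = refl , b≡true

∧-true⁺ : ∀ {a b} → a ≡ true → b ≡ true → a ∧ b ≡ true
∧-true⁺ refl refl = refl

∨-true⁻ : ∀ {a b} → a ∨ b ≡ true → a ≡ true ⊎ b ≡ true
∨-true⁻ {true}  _ = inj₁ refl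
∨-true⁻ {false} b≡true = inj₂ b≡true

does-≟-sound : ∀ {r} {a b : Fin r} → does (a ≟ b) ≡ true → a ≡ b
does-≟-sound {a = a} {b} e with a ≟ b
... | yes a≡b = a≡b

does-≟-refl : ∀ {r} (a : Fin r) → does (a ≟ a) ≡ true
does-≟-refl a with a ≟ a
... | yes _ = refl
... | no a≢a = ⊥-elim (a≢a refl)

∑≡sum : ∀ {N} (g : Fin N → ℕ) → ∑ g ≡ sum g
∑≡sum {zero}  g = refl
∑≡sum {suc N} g = cong (g zero +_) (∑≡sum (g ∘ suc))

∑-cong : ∀ {N} {g h : Fin N → ℕ} → (∀ j → g j ≡ h j) → ∑ g ≡ ∑ h
∑-cong {g = g} {h} g≗h = trans (∑≡sum g) (trans (Sum.sum-cong-≗ g≗h) (sym (∑≡sum h)))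

∑-zero : ∀ N → ∑ {N} (λ _ → 0) ≡ 0
∑-zero N = trans (∑≡sum {N} (λ _ → 0)) (Sum.sum-replicate-zero N)

∑-distrib-+ : ∀ {N} (g h : Fin N → ℕ) → ∑ (λ j → g j + h j) ≡ ∑ g + ∑ h
∑-distrib-+ g h = begin
  ∑ (λ j → g j + h j)  ≡⟨ ∑≡sum (λ j → g j + h j) ⟩
  sum (λ j → g j + h j) ≡⟨ Sum.∑-distrib-+ g h ⟩
  sum g + sum h         ≡⟨ sym (cong₂ _+_ (∑≡sum g) (∑≡sum h)) ⟩
  ∑ g + ∑ h             ∎
  where open ≡-Reasoning

∑-comm : ∀ {A B} (g : Fin A → Fin B → ℕ) → ∑ (λ a → ∑ (g a)) ≡ ∑ (λ b → ∑ (λ a → g a b))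
∑-comm g = begin
  ∑ (λ a → ∑ (g a))                ≡⟨ ∑∑≡sumsum g ⟩
  sum (λ a → sum (g a))            ≡⟨ Sum.∑-comm g ⟩
  sum (λ b → sum (λ a → g a b))    ≡⟨ sym (∑∑≡sumsum (flip g)) ⟩
  ∑ (λ b → ∑ (λ a → g a b))        ∎
  where
  open ≡-Reasoning
  ∑∑≡sumsum : ∀ {A B} (g : Fin A → Fin B → ℕ) → ∑ (λ a → ∑ (g a)) ≡ sum (λ a → sum (g a))
  ∑∑≡sumsum g = trans (∑≡sum (λ a → ∑ (g a))) (Sum.sum-cong-≗ (λ a → ∑≡sum (g a)))

∑-mono-≤ : ∀ {N} {g h : Fin N → ℕ} → (∀ j → g j ≤ h j) → ∑ g ≤ ∑ h
∑-mono-≤ {zero}  g≤h = z≤n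
∑-mono-≤ {suc N} g≤h = +-mono-≤ (g≤h zero) (∑-mono-≤ (g≤h ∘ suc))

∑-mono-< : ∀ {N} {g h : Fin N → ℕ} → (∀ j → g j ≤ h j) → ∀ i → g i < h i → ∑ g < ∑ h
∑-mono-< {suc N} g≤h zero    gi<hi = +-mono-<-≤ gi<hi (∑-mono-≤ (g≤h ∘ suc))
∑-mono-< {suc N} g≤h (suc i) gi<hi = +-mono-≤-< (g≤h zero) (∑-mono-< (g≤h ∘ suc) i gi<hi)

≤-∑ : ∀ {N} (g : Fin N → ℕ) i → g i ≤ ∑ g
≤-∑ g zero    = m≤m+n _ _
≤-∑ g (suc i) = ≤-trans (≤-∑ (g ∘ suc) i) (m≤n+m _ _)

∑-const-1 : ∀ N → ∑ {N} (λ _ → 1) ≡ N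
∑-const-1 zero    = refl
∑-const-1 (suc N) = cong suc (∑-const-1 N)

∑-select : ∀ {N} (i : Fin N) (h : Fin N → ℕ) → ∑ (λ j → if does (i ≟ j) then h j else 0) ≡ h i
∑-select {suc N} zero    h = trans (cong (h zero +_) (∑-zero N)) (+-identityʳ (h zero))
∑-select {suc N} (suc i) h = ∑-select i (h ∘ suc)

∑-if : ∀ {N} (b : Bool) (g : Fin N → ℕ) → ∑ (λ j → if b then g j else 0) ≡ (if b then ∑ g else 0)
∑-if     true  g = refl
∑-if {N} false g = ∑-zero N

∑in-complement : ∀ {r} (R : Fin r → Bool) (f : Fin r → ℕ) → ∑in R f + ∑in (not ∘ R) f ≡ ∑ f
∑in-complement R f = trans (sym (∑-distrib-+ (λ c → if R c then f c else 0) (λ c → if not (R c) then f c else 0))) (∑-cong split)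
  where
  split : ∀ c → (if R c then f c else 0) + (if not (R c) then f c else 0) ≡ f c
  split c with R c
  ... | true  = +-identityʳ (f c)
  ... | false = refl

concatF : ∀ {m} {X : Set} → (Fin m → List X) → List X
concatF {zero}  g = []
concatF {suc m} g = g zero ++ concatF (g ∘ suc)

module _ {X : Set} where

  concatF-cong : ∀ {m} {g h : Fin m → List X} → (∀ j → g j ≡ h j) → concatF g ≡ concatF h
  concatF-cong {zero}  g≗h = refl
  concatF-cong {suc m} g≗h = cong₂ _++_ (g≗h zero) (concatF-cong (g≗h ∘ suc))

  ∈-concatF⁺ : ∀ {m} (g : Fin m → List X) {x} j → x ∈ g j → x ∈ concatF g
  ∈-concatF⁺ g zero    x∈ = ∈-++⁺ˡ x∈
  ∈-concatF⁺ g (suc j) x∈ = ∈-++⁺ʳ (g zero) (∈-concatF⁺ (g ∘ suc) j x∈)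

  ∈-concatF⁻ : ∀ {m} (g : Fin m → List X) {x} → x ∈ concatF g → ∃ λ j → x ∈ g j
  ∈-concatF⁻ {suc m} g x∈ with ∈-++⁻ (g zero) x∈
  ... | inj₁ x∈g₀ = zero , x∈g₀
  ... | inj₂ x∈gs with ∈-concatF⁻ (g ∘ suc) x∈gs
  ...   | j , x∈gj = suc j , x∈gj

  concatF-[] : ∀ {m} (g : Fin m → List X) → (∀ j → g j ≡ []) → concatF g ≡ []
  concatF-[] {zero}  g g≡[] = refl
  concatF-[] {suc m} g g≡[] rewrite g≡[] zero = concatF-[] (g ∘ suc) (g≡[] ∘ suc)

  length-concatF : ∀ {m} (g : Fin m → List X) → length (concatF g) ≡ ∑ (length ∘ g)
  length-concatF {zero}  g = refl
  length-concatF {suc m} g = trans (length-++ (g zero)) (cong (length (g zero) +_) (length-concatF (g ∘ suc)))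

  concatF-unique : ∀ {m} (g : Fin m → List X) → (∀ {i j x} → x ∈ g i → x ∈ g j → i ≡ j) →
                   (∀ j → Unique (g j)) → Unique (concatF g)
  concatF-unique {zero}  g disjoint unique = []
  concatF-unique {suc m} g disjoint unique =
    ++⁺ (unique zero) (concatF-unique (g ∘ suc) (λ x∈ x∈′ → suc-injective (disjoint x∈ x∈′)) (unique ∘ suc)) apart
    where
    apart : ∀ {x} → ¬ (x ∈ g zero × x ∈ concatF (g ∘ suc))
    apart (x∈g₀ , x∈gs) with ∈-concatF⁻ (g ∘ suc) x∈gs
    ... | j , x∈gj with disjoint x∈g₀ x∈gj
    ...   | ()

Edge : ℕ → Set
Edge n = Fin n × Fin n

module _ {n : ℕ} where

  singletonIf : Bool → Edge n → List (Edge n)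
  singletonIf b e = if b then [ e ] else []

  edgesOf : (Fin n → Fin n → Bool) → List (Edge n)
  edgesOf Q = concatF (λ u → concatF (λ v → singletonIf (Q u v) (u , v)))

  ∈-edgesOf⁺ : ∀ Q {u v} → Q u v ≡ true → (u , v) ∈ edgesOf Q
  ∈-edgesOf⁺ Q {u} {v} Quv = ∈-concatF⁺ _ u (∈-concatF⁺ (λ v → singletonIf (Q u v) (u , v)) v (subst (λ b → (u , v) ∈ singletonIf b (u , v)) (sym Quv) (here refl)))

  ∈-edgesOf⁻ : ∀ Q {u v} → (u , v) ∈ edgesOf Q → Q u v ≡ true
  ∈-edgesOf⁻ Q e∈ with ∈-concatF⁻ _ e∈
  ... | u , e∈u with ∈-concatF⁻ _ e∈u
  ...   | v , e∈uv with Q u v in Quv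
  ∈-edgesOf⁻ Q e∈ | u , e∈u | v , here refl | true = Quv

  length-edgesOf : ∀ Q → length (edgesOf Q) ≡ ∑ (λ u → ∑ (λ v → ⟦ Q u v ⟧))
  length-edgesOf Q =
    trans (length-concatF (λ u → concatF (λ v → singletonIf (Q u v) (u , v)))) (∑-cong (λ u → trans (length-concatF (λ v → singletonIf (Q u v) (u , v))) (∑-cong (λ v → length-singletonIf (Q u v)))))
    where
    length-singletonIf : ∀ b {e} → length (singletonIf b e) ≡ ⟦ b ⟧
    length-singletonIf true  = refl
    length-singletonIf false = refl

  edgesOf-unique : ∀ Q → Unique (edgesOf Q)
  edgesOf-unique Q = concatF-unique _ sameSource (λ u → concatF-unique _ (sameTarget u) (λ v → unique (Q u v)))
    where
    unique : ∀ b {e} → Unique (singletonIf b e)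
    unique true  = [] ∷ []
    unique false = []
    endpoint : ∀ b {e x} → x ∈ singletonIf b e → x ≡ e
    endpoint true (here x≡e) = x≡e
    sameTarget : ∀ u {v v′ x} → x ∈ singletonIf (Q u v) (u , v) → x ∈ singletonIf (Q u v′) (u , v′) → v ≡ v′
    sameTarget u x∈ x∈′ = cong proj₂ (trans (sym (endpoint _ x∈)) (endpoint _ x∈′))
    source : ∀ {u x} → x ∈ concatF (λ v → singletonIf (Q u v) (u , v)) → proj₁ x ≡ u
    source {u} x∈ with ∈-concatF⁻ (λ v → singletonIf (Q u v) (u , v)) x∈
    ... | v , x∈v = cong proj₁ (endpoint _ x∈v)
    sameSource : ∀ {u u′ x} → x ∈ concatF (λ v → singletonIf (Q u v) (u , v)) → x ∈ concatF (λ v → singletonIf (Q u′ v) (u′ , v)) → u ≡ u′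
    sameSource x∈ x∈′ = trans (sym (source x∈)) (source x∈′)

collapse : ∀ {k} (b a : Fin (suc k)) → b ≢ a → Fin (suc k) → Fin k
collapse b a b≢a x with b ≟ x
... | yes _   = punchOut b≢a
... | no b≢x  = punchOut b≢x

collapse-identifies : ∀ {k} (b a : Fin (suc k)) (b≢a : b ≢ a) → collapse b a b≢a a ≡ collapse b a b≢a b
collapse-identifies b a b≢a with b ≟ a | b ≟ b
... | yes b≡a | _       = ⊥-elim (b≢a b≡a)
... | no _    | yes _   = punchOut-cong b refl
... | no _    | no b≢b  = ⊥-elim (b≢b refl)

collapse-kernel : ∀ {k} (b a : Fin (suc k)) (b≢a : b ≢ a) x y → collapse b a b≢a x ≡ collapse b a b≢a y →
                  x ≡ y ⊎ (x ≡ a × y ≡ b) ⊎ (x ≡ b × y ≡ a)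
collapse-kernel b a b≢a x y eq with b ≟ x | b ≟ y
... | yes b≡x | yes b≡y = inj₁ (trans (sym b≡x) b≡y)
... | yes b≡x | no b≢y  = inj₂ (inj₂ (sym b≡x , sym (punchOut-injective b≢a b≢y eq)))
... | no b≢x  | yes b≡y = inj₂ (inj₁ (punchOut-injective b≢x b≢a eq , sym b≡y))
... | no b≢x  | no b≢y  = inj₁ (punchOut-injective b≢x b≢y eq)

collapse-punchIn : ∀ {k} (b a : Fin (suc k)) (b≢a : b ≢ a) y → collapse b a b≢a (punchIn b y) ≡ y
collapse-punchIn b a b≢a y with b ≟ punchIn b y
... | yes b≡ = ⊥-elim (punchInᵢ≢i b y (sym b≡))
... | no _   = trans (punchOut-cong b refl) (punchOut-punchIn b)

record Partition (n : ℕ) : Set where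
  constructor partition
  field
    size       : ℕ
    block      : Fin n → Fin size
    block-onto : ∀ b → ∃ λ x → block x ≡ b
open Partition public

onto-coarsening⇒≤ : ∀ {n k k′} (q : Fin n → Fin k) (q′ : Fin n → Fin k′) → (∀ b → ∃ λ x → q′ x ≡ b) →
                    (∀ x y → q x ≡ q y → q′ x ≡ q′ y) → k′ ≤ k
onto-coarsening⇒≤ q q′ onto coarser = injective⇒≤ {f = λ b → q (proj₁ (onto b))} injective
  where
  injective : ∀ {a b} → q (proj₁ (onto a)) ≡ q (proj₁ (onto b)) → a ≡ b
  injective {a} {b} eq = trans (sym (proj₂ (onto a))) (trans (coarser _ _ eq) (proj₂ (onto b)))

module _ {n : ℕ} where

  discrete : Partition n
  discrete = partition n (λ x → x) (λ b → b , refl)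

  record Merge (P : Partition n) (u v : Fin n) : Set where
    field
      merged            : Partition n
      size-merged       : size P ≡ suc (size merged)
      merged-coarsens   : ∀ x y → block P x ≡ block P y → block merged x ≡ block merged y
      merged-identifies : block merged u ≡ block merged v
      merged-kernel     : ∀ x y → block merged x ≡ block merged y →
                          block P x ≡ block P y
                          ⊎ (block P x ≡ block P u × block P y ≡ block P v)
                          ⊎ (block P x ≡ block P v × block P y ≡ block P u)

  merge : ∀ P u v → block P u ≢ block P v → Merge P u v
  merge (partition zero    blk onto) u v _ with blk u
  ... | ()
  merge (partition (suc k) blk onto) u v bu≢bv = record
    { merged            = partition k (squash ∘ blk) squash-onto
    ; size-merged       = refl
    ; merged-coarsens   = λ x y → cong squash
    ; merged-identifies = collapse-identifies (blk v) (blk u) bv≢bu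
    ; merged-kernel     = λ x y → collapse-kernel (blk v) (blk u) bv≢bu (blk x) (blk y)
    }
    where
    bv≢bu = bu≢bv ∘ sym
    squash = collapse (blk v) (blk u) bv≢bu
    squash-onto : ∀ b → ∃ λ x → squash (blk x) ≡ b
    squash-onto b with onto (punchIn (blk v) b)
    ... | x , blk-x≡ = x , trans (cong squash blk-x≡) (collapse-punchIn (blk v) (blk u) bv≢bu b)

  data Linked (P : Partition n) (L : List (Edge n)) : Fin n → Fin n → Set where
    same : ∀ {x y} → block P x ≡ block P y → Linked P L x y
    edge : ∀ {x y} → (x , y) ∈ L → Linked P L x y
    inv  : ∀ {x y} → Linked P L x y → Linked P L y x
    _∙_  : ∀ {x y z} → Linked P L x y → Linked P L y z → Linked P L x z

  Linked-map : ∀ {P Q L M} → (∀ {x y} → block P x ≡ block P y → Linked Q M x y) →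
               (∀ {x y} → (x , y) ∈ L → Linked Q M x y) → ∀ {x y} → Linked P L x y → Linked Q M x y
  Linked-map blocks edges (same eq)   = blocks eq
  Linked-map blocks edges (edge e∈)   = edges e∈
  Linked-map blocks edges (inv p)     = inv (Linked-map blocks edges p)
  Linked-map blocks edges (p ∙ q)     = Linked-map blocks edges p ∙ Linked-map blocks edges q

  Linked-⊆ : ∀ {P L M} → (∀ {e} → e ∈ L → e ∈ M) → ∀ {x y} → Linked P L x y → Linked P M x y
  Linked-⊆ L⊆M = Linked-map same (edge ∘ L⊆M)

  join : Partition n → Edge n → Partition n
  join P (u , v) with block P u ≟ block P v
  ... | yes _     = P
  ... | no bu≢bv  = Merge.merged (merge P u v bu≢bv)

  gain : Partition n → Edge n → ℕ
  gain P (u , v) with block P u ≟ block P v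
  ... | yes _ = 0
  ... | no _  = 1

  gain≤1 : ∀ P e → gain P e ≤ 1
  gain≤1 P (u , v) with block P u ≟ block P v
  ... | yes _ = z≤n
  ... | no _  = ≤-refl

  size-join : ∀ P e → size P ≡ gain P e + size (join P e)
  size-join P (u , v) with block P u ≟ block P v
  ... | yes _    = refl
  ... | no bu≢bv = Merge.size-merged (merge P u v bu≢bv)

  join-coarsens : ∀ P e x y → block P x ≡ block P y → block (join P e) x ≡ block (join P e) y
  join-coarsens P (u , v) x y eq with block P u ≟ block P v
  ... | yes _    = eq
  ... | no bu≢bv = Merge.merged-coarsens (merge P u v bu≢bv) x y eq

  join-identifies : ∀ P u v → block (join P (u , v)) u ≡ block (join P (u , v)) v
  join-identifies P u v with block P u ≟ block P v
  ... | yes bu≡bv = bu≡bv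
  ... | no bu≢bv  = Merge.merged-identifies (merge P u v bu≢bv)

  join-kernel : ∀ P e x y → block (join P e) x ≡ block (join P e) y → Linked P [ e ] x y
  join-kernel P (u , v) x y eq with block P u ≟ block P v
  ... | yes _ = same eq
  ... | no bu≢bv with Merge.merged-kernel (merge P u v bu≢bv) x y eq
  ...   | inj₁ bx≡by                = same bx≡by
  ...   | inj₂ (inj₁ (bx≡bu , by≡bv)) = same bx≡bu ∙ (edge (here refl) ∙ same (sym by≡bv))
  ...   | inj₂ (inj₂ (bx≡bv , by≡bu)) = same bx≡bv ∙ (inv (edge (here refl)) ∙ same (sym by≡bu))

  joinAll : Partition n → List (Edge n) → Partition n
  joinAll P []      = P
  joinAll P (e ∷ L) = joinAll (join P e) L

  -- The rank of L in the graphic matroid, relative to P.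
  merges : Partition n → List (Edge n) → ℕ
  merges P []      = 0
  merges P (e ∷ L) = gain P e + merges (join P e) L

  size-joinAll : ∀ P L → size P ≡ merges P L + size (joinAll P L)
  size-joinAll P []      = refl
  size-joinAll P (e ∷ L) = begin
    size P                                          ≡⟨ size-join P e ⟩
    gain P e + size (join P e)                      ≡⟨ cong (gain P e +_) (size-joinAll (join P e) L) ⟩
    gain P e + (merges (join P e) L + size (joinAll (join P e) L)) ≡⟨ +-assoc (gain P e) _ _ ⟨
    merges P (e ∷ L) + size (joinAll P (e ∷ L))    ∎
    where open ≡-Reasoning

  merges≤length : ∀ P L → merges P L ≤ length L
  merges≤length P []      = z≤n
  merges≤length P (e ∷ L) = +-mono-≤ (gain≤1 P e) (merges≤length (join P e) L)

  joinAll-++ : ∀ P L M → joinAll P (L ++ M) ≡ joinAll (joinAll P L) M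
  joinAll-++ P []      M = refl
  joinAll-++ P (e ∷ L) M = joinAll-++ (join P e) L M

  joinAll-coarsens : ∀ P L x y → block P x ≡ block P y → block (joinAll P L) x ≡ block (joinAll P L) y
  joinAll-coarsens P []      x y eq = eq
  joinAll-coarsens P (e ∷ L) x y eq = joinAll-coarsens (join P e) L x y (join-coarsens P e x y eq)

  linked⇒sameBlock : ∀ P L {x y} → Linked P L x y → block (joinAll P L) x ≡ block (joinAll P L) y
  linked⇒sameBlock P L (same eq) = joinAll-coarsens P L _ _ eq
  linked⇒sameBlock P ((u , v) ∷ L) (edge (here refl)) = joinAll-coarsens (join P (u , v)) L u v (join-identifies P u v)
  linked⇒sameBlock P (e ∷ L) (edge (there e∈)) = linked⇒sameBlock (join P e) L (edge e∈)
  linked⇒sameBlock P L (inv p) = sym (linked⇒sameBlock P L p)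
  linked⇒sameBlock P L (p ∙ q) = trans (linked⇒sameBlock P L p) (linked⇒sameBlock P L q)

  sameBlock⇒linked : ∀ P L x y → block (joinAll P L) x ≡ block (joinAll P L) y → Linked P L x y
  sameBlock⇒linked P []      x y eq = same eq
  sameBlock⇒linked P (e ∷ L) x y eq =
    Linked-map (Linked-map same (λ { (here refl) → edge (here refl) }) ∘ join-kernel P e _ _)
               (edge ∘ there) (sameBlock⇒linked (join P e) L x y eq)

  Linked-⇒-size-≤ : ∀ P L P′ L′ → (∀ {x y} → Linked P L x y → Linked P′ L′ x y) →
                    size (joinAll P′ L′) ≤ size (joinAll P L)
  Linked-⇒-size-≤ P L P′ L′ L⇒L′ =
    onto-coarsening⇒≤ (block (joinAll P L)) (block (joinAll P′ L′)) (block-onto (joinAll P′ L′))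
      (λ x y eq → linked⇒sameBlock P′ L′ (L⇒L′ (sameBlock⇒linked P L x y eq)))

  _⊑_ : Partition n → Partition n → Set
  P ⊑ Q = ∀ x y → block P x ≡ block P y → block Q x ≡ block Q y

  join-monotone : ∀ P Q e → P ⊑ Q → join P e ⊑ join Q e
  join-monotone P Q e P⊑Q x y eq =
    linked⇒sameBlock Q [ e ] (Linked-map (same ∘ P⊑Q _ _) edge (join-kernel P e x y eq))

  gain-antitone : ∀ P Q e → P ⊑ Q → gain Q e ≤ gain P e
  gain-antitone P Q (u , v) P⊑Q with block P u ≟ block P v | block Q u ≟ block Q v
  ... | yes _     | yes _      = z≤n
  ... | yes bu≡bv | no bu≢bv   = ⊥-elim (bu≢bv (P⊑Q u v bu≡bv))
  ... | no _      | yes _      = z≤n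
  ... | no _      | no _       = ≤-refl

  merges-antitone : ∀ P Q L → P ⊑ Q → merges Q L ≤ merges P L
  merges-antitone P Q []      P⊑Q = z≤n
  merges-antitone P Q (e ∷ L) P⊑Q =
    +-mono-≤ (gain-antitone P Q e P⊑Q) (merges-antitone (join P e) (join Q e) L (join-monotone P Q e P⊑Q))

  size-antitone : ∀ P {L M} → L ⊆ M → size (joinAll P M) ≤ size (joinAll P L)
  size-antitone P L⊆M = Linked-⇒-size-≤ P _ P _ (Linked-⊆ L⊆M)

  -- Submodularity of the matroid rank L ↦ size P ∸ size (joinAll P L).
  size-submodular : ∀ P {W X Y Z} → W ⊆ X → W ⊆ Y → Z ⊆ X ++ Y →
                    size (joinAll P X) + size (joinAll P Y) ≤ size (joinAll P Z) + size (joinAll P W)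
  size-submodular P {W} {X} {Y} {Z} W⊆X W⊆Y Z⊆X++Y = begin
    size PX + size (joinAll P Y)                       ≡⟨ cong (_+ size (joinAll P Y)) (size-joinAll PX Y) ⟩
    merges PX Y + size (joinAll PX Y) + size (joinAll P Y) ≤⟨ +-mono-≤ (+-mono-≤ fewer-merges PXY≤PZ) PY≤PWY ⟩
    merges PW Y + size (joinAll P Z) + size (joinAll PW Y) ≡⟨ rearrange (merges PW Y) _ _ ⟩
    size (joinAll P Z) + (merges PW Y + size (joinAll PW Y)) ≡⟨ cong (size (joinAll P Z) +_) (size-joinAll PW Y) ⟨
    size (joinAll P Z) + size PW                       ∎
    where
    open ≤-Reasoning
    PW = joinAll P W
    PX = joinAll P X
    fewer-merges : merges PX Y ≤ merges PW Y
    fewer-merges = merges-antitone PW PX Y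
      (λ x y eq → linked⇒sameBlock P X (Linked-⊆ W⊆X (sameBlock⇒linked P W x y eq)))
    PXY≤PZ : size (joinAll PX Y) ≤ size (joinAll P Z)
    PXY≤PZ = subst (λ Q → size Q ≤ size (joinAll P Z)) (joinAll-++ P X Y) (size-antitone P Z⊆X++Y)
    PY≤PWY : size (joinAll P Y) ≤ size (joinAll PW Y)
    PY≤PWY = Linked-⇒-size-≤ PW Y P Y
      (Linked-map (λ {x} {y} eq → Linked-⊆ W⊆Y (sameBlock⇒linked P W x y eq)) edge)
    rearrange : ∀ a b c → a + b + c ≡ b + (a + c)
    rearrange = solve-∀

module _ {n : ℕ} where

  edgeList : ∀ {N} → (Fin N → Edge n) → List (Edge n)
  edgeList a = concatF (λ i → [ a i ])

  length-edgeList : ∀ {N} (a : Fin N → Edge n) → length (edgeList a) ≡ N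
  length-edgeList {N} a = trans (length-concatF (λ i → [ a i ])) (∑-const-1 N)

  ∈-edgeList⁺ : ∀ {N} (a : Fin N → Edge n) i → a i ∈ edgeList a
  ∈-edgeList⁺ a i = ∈-concatF⁺ (λ i → [ a i ]) i (here refl)

  ∈-edgeList⁻ : ∀ {N} (a : Fin N → Edge n) {e} → e ∈ edgeList a → ∃ λ i → e ≡ a i
  ∈-edgeList⁻ a e∈ with ∈-concatF⁻ (λ i → [ a i ]) e∈
  ... | i , here e≡ai = i , e≡ai

∣_∣ : ∀ {N} → (Fin N → Bool) → ℕ
∣ I ∣ = ∑ (λ j → ⟦ I j ⟧)

⁅_⁆ : ∀ {N} → Fin N → Fin N → Bool
⁅ i ⁆ j = does (i ≟ j)

∣⁅⁆∣ : ∀ {N} (i : Fin N) → ∣ ⁅ i ⁆ ∣ ≡ 1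
∣⁅⁆∣ i = ∑-select i (λ _ → 1)

_∪_ _∩_ : ∀ {N} → (Fin N → Bool) → (Fin N → Bool) → Fin N → Bool
(I ∪ J) j = I j ∨ J j
(I ∩ J) j = I j ∧ J j

∁ : ∀ {N} → (Fin N → Bool) → Fin N → Bool
∁ I = not ∘ I

∉⁅⁆ : ∀ {N} {i j : Fin N} → ∁ ⁅ i ⁆ j ≡ true → i ≢ j
∉⁅⁆ {i = i} j∉ refl with i ≟ i | j∉
... | yes _  | ()
... | no i≢i | _ = i≢i refl

inclusion-exclusion : ∀ {N} (I J : Fin N → Bool) i → I i ≡ true → J i ≡ true →
                      ∣ I ∪ J ∣ + ∣ I ∩ (J ∩ ∁ ⁅ i ⁆) ∣ + 1 ≡ ∣ I ∣ + ∣ J ∣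
inclusion-exclusion I J i Ii Ji = begin
  ∣ I ∪ J ∣ + ∣ C ∣ + 1                          ≡⟨ cong₂ _+_ (∑-distrib-+ (λ j → ⟦ (I ∪ J) j ⟧) (λ j → ⟦ C j ⟧)) (∣⁅⁆∣ i) ⟨
  ∑ (λ j → ⟦ (I ∪ J) j ⟧ + ⟦ C j ⟧) + ∣ ⁅ i ⁆ ∣    ≡⟨ ∑-distrib-+ (λ j → ⟦ (I ∪ J) j ⟧ + ⟦ C j ⟧) (λ j → ⟦ ⁅ i ⁆ j ⟧) ⟨
  ∑ (λ j → ⟦ (I ∪ J) j ⟧ + ⟦ C j ⟧ + ⟦ ⁅ i ⁆ j ⟧)  ≡⟨ ∑-cong pointwise ⟩
  ∑ (λ j → ⟦ I j ⟧ + ⟦ J j ⟧)                    ≡⟨ ∑-distrib-+ (λ j → ⟦ I j ⟧) (λ j → ⟦ J j ⟧) ⟩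
  ∣ I ∣ + ∣ J ∣                                  ∎
  where
  open ≡-Reasoning
  C = I ∩ (J ∩ ∁ ⁅ i ⁆)
  pointwise : ∀ j → ⟦ (I ∪ J) j ⟧ + ⟦ C j ⟧ + ⟦ ⁅ i ⁆ j ⟧ ≡ ⟦ I j ⟧ + ⟦ J j ⟧
  pointwise j with i ≟ j
  ... | yes refl rewrite Ii | Ji = refl
  ... | no _ with I j | J j
  ...   | true  | true  = refl
  ...   | true  | false = refl
  ...   | false | true  = refl
  ...   | false | false = refl

all-subsets? : ∀ N (Q : (Fin N → Bool) → Set) → (∀ I → Dec (Q I)) → (∀ {I J} → (∀ j → I j ≡ J j) → Q I → Q J) →
               (∀ I → Q I) ⊎ ∃ λ I → ¬ Q I
all-subsets? zero Q Q? Q-resp with Q? (λ ())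
... | yes q  = inj₁ (λ I → Q-resp (λ ()) q)
... | no ¬q  = inj₂ ((λ ()) , ¬q)
all-subsets? (suc N) Q Q? Q-resp
  with all-subsets? N (Q ∘ (true Vec.∷_)) (Q? ∘ (true Vec.∷_)) (Q-resp ∘ ∷-cong refl)
     | all-subsets? N (Q ∘ (false Vec.∷_)) (Q? ∘ (false Vec.∷_)) (Q-resp ∘ ∷-cong refl)
... | inj₂ (I , ¬q) | _             = inj₂ (_ , ¬q)
... | inj₁ _        | inj₂ (I , ¬q) = inj₂ (_ , ¬q)
... | inj₁ q₁       | inj₁ q₀       = inj₁ (λ I → Q-resp (∷-cong refl (λ _ → refl)) (by-head (I zero) (I ∘ suc)))
  where
  by-head : ∀ b I → Q (b Vec.∷ I)
  by-head true  = q₁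
  by-head false = q₀

_[_]≔_ : ∀ {N} {X : Set} → (Fin N → X) → Fin N → X → Fin N → X
A [ i ]≔ x = Vec.updateAt A i (λ _ → x)

-- Rado's theorem for the rank function of the graphic matroid (relative to a partition P):
-- a family of edge lists has a transversal of full rank as soon as every subfamily does.
module Rado {n : ℕ} (P : Partition n) where

  ⋃ : ∀ {N} → (Fin N → List (Edge n)) → (Fin N → Bool) → List (Edge n)
  ⋃ A I = concatF (λ j → if I j then A j else [])

  ∈-⋃⁺ : ∀ {N} (A : Fin N → List (Edge n)) I {e} j → I j ≡ true → e ∈ A j → e ∈ ⋃ A I
  ∈-⋃⁺ A I j Ij e∈ = ∈-concatF⁺ _ j (subst (λ b → _ ∈ (if b then A j else [])) (sym Ij) e∈)

  ∈-⋃⁻ : ∀ {N} (A : Fin N → List (Edge n)) I {e} → e ∈ ⋃ A I → ∃ λ j → I j ≡ true × e ∈ A j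
  ∈-⋃⁻ A I e∈ with ∈-concatF⁻ _ e∈
  ... | j , e∈j with I j in Ij
  ...   | true = j , Ij , e∈j

  RadoSet : ∀ {N} → (Fin N → List (Edge n)) → (Fin N → Bool) → Set
  RadoSet A I = ∣ I ∣ + size (joinAll P (⋃ A I)) ≤ size P

  RadoCondition : ∀ {N} → (Fin N → List (Edge n)) → Set
  RadoCondition A = ∀ I → RadoSet A I

  RadoSet? : ∀ {N} (A : Fin N → List (Edge n)) I → Dec (RadoSet A I)
  RadoSet? A I = _ ≤? _

  RadoSet-resp : ∀ {N} (A : Fin N → List (Edge n)) {I J} → (∀ j → I j ≡ J j) → RadoSet A I → RadoSet A J
  RadoSet-resp A I≗J = subst₂ (λ c L → c + size (joinAll P L) ≤ size P) (∑-cong (cong ⟦_⟧ ∘ I≗J))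
                              (concatF-cong (λ j → cong (λ b → if b then A j else []) (I≗J j)))

  IndependentTransversal : ∀ {N} → (Fin N → List (Edge n)) → Set
  IndependentTransversal {N} A = Σ (Fin N → Edge n) λ a → (∀ i → a i ∈ A i) × merges P (edgeList a) ≡ N

  transversal-⊆ : ∀ {N} (A B : Fin N → List (Edge n)) → (∀ j → B j ⊆ A j) →
                  IndependentTransversal B → IndependentTransversal A
  transversal-⊆ A B B⊆A (a , a∈B , indep) = a , (λ i → B⊆A i (a∈B i)) , indep

  -- When every list has at most one element, the condition on singletons forces exactly one,
  -- and the condition on the whole family forces independence.
  transversal-of-short : ∀ {N} (A : Fin N → List (Edge n)) → (∀ i → ¬ 2 ≤ length (A i)) →
                         RadoCondition A → IndependentTransversal A
  transversal-of-short {N} A short cond =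
    a , a∈A , ≤-antisym (≤-trans (merges≤length P (edgeList a)) (≤-reflexive (length-edgeList a))) N≤merges
    where
    singleton : ∀ i → ∃ λ e → A i ≡ [ e ]
    singleton i with A i in Ai≡ | short i
    ... | []        | _ = ⊥-elim (1+n≰n (subst₂ (λ c L → c + size (joinAll P L) ≤ size P) (∣⁅⁆∣ i) ⋃≡[] (cond ⁅ i ⁆)))
      where
      ⋃≡[] : ⋃ A ⁅ i ⁆ ≡ []
      ⋃≡[] = concatF-[] _ only-i
        where
        only-i : ∀ j → (if does (i ≟ j) then A j else []) ≡ []
        only-i j with i ≟ j
        ... | yes refl = Ai≡
        ... | no _     = refl
    ... | e ∷ []    | _ = e , refl
    ... | _ ∷ _ ∷ _ | ¬2≤ = ⊥-elim (¬2≤ (s≤s (s≤s z≤n)))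
    a : Fin N → Edge n
    a = proj₁ ∘ singleton
    a∈A : ∀ i → a i ∈ A i
    a∈A i = subst (a i ∈_) (sym (proj₂ (singleton i))) (here refl)
    N≤merges : N ≤ merges P (edgeList a)
    N≤merges = +-cancelʳ-≤ (size (joinAll P (edgeList a))) N _ (begin
      N + size (joinAll P (edgeList a))                     ≡⟨ cong₂ (λ c L → c + size (joinAll P L)) (∑-const-1 N) ⋃≡edgeList ⟨
      ∣ everything ∣ + size (joinAll P (⋃ A everything))    ≤⟨ cond everything ⟩
      size P                                                ≡⟨ size-joinAll P (edgeList a) ⟩
      merges P (edgeList a) + size (joinAll P (edgeList a)) ∎)
      where
      open ≤-Reasoning
      everything : Fin N → Bool
      everything _ = true
      ⋃≡edgeList : ⋃ A everything ≡ edgeList a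
      ⋃≡edgeList = concatF-cong (proj₂ ∘ singleton)

  RadoSet-update : ∀ {N} (A : Fin N → List (Edge n)) i L I → I i ≡ false → RadoSet A I → RadoSet (A [ i ]≔ L) I
  RadoSet-update A i L I Ii≡false = subst (λ M → ∣ I ∣ + size (joinAll P M) ≤ size P) (concatF-cong unchanged)
    where
    unchanged : ∀ j → (if I j then A j else []) ≡ (if I j then (A [ i ]≔ L) j else [])
    unchanged j with I j in Ij
    ... | false = refl
    ... | true  = sym (updateAt-minimal j i A i≢j)
      where
      i≢j : j ≢ i
      i≢j refl with trans (sym Ii≡false) Ij
      ... | ()

  violator-contains : ∀ {N} (A : Fin N → List (Edge n)) i L I → RadoCondition A → ¬ RadoSet (A [ i ]≔ L) I → I i ≡ true
  violator-contains A i L I cond violated with I i in Ii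
  ... | true  = refl
  ... | false = ⊥-elim (violated (RadoSet-update A i L I Ii (cond I)))

  ⋃-update-⊇ : ∀ {N} (A : Fin N → List (Edge n)) i {r L} (C K : Fin N → Bool) → K i ≡ true → r ⊆ L →
               (∀ {j} → C j ≡ true → K j ≡ true × i ≢ j) → ⋃ A C ++ r ⊆ ⋃ (A [ i ]≔ L) K
  ⋃-update-⊇ A i C K Ki r⊆L C⊆K∖i e∈ with ∈-++⁻ (⋃ A C) e∈
  ... | inj₂ e∈r = ∈-⋃⁺ _ K i Ki (subst (_ ∈_) (sym (updateAt-updates i A)) (r⊆L e∈r))
  ... | inj₁ e∈C with ∈-⋃⁻ A C e∈C
  ...   | j , Cj , e∈Aj with C⊆K∖i Cj
  ...     | Kj , i≢j = ∈-⋃⁺ _ K j Kj (subst (_ ∈_) (sym (updateAt-minimal j i A (i≢j ∘ sym))) e∈Aj)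

  ⋃-∪-⊆ : ∀ {N} (A : Fin N → List (Edge n)) i {x y r} → A i ≡ x ∷ y ∷ r → ∀ I J → I i ≡ true → J i ≡ true →
          ⋃ A (I ∪ J) ⊆ ⋃ (A [ i ]≔ (y ∷ r)) I ++ ⋃ (A [ i ]≔ (x ∷ r)) J
  ⋃-∪-⊆ A i Ai≡ I J Ii Ji e∈ with ∈-⋃⁻ A (I ∪ J) e∈
  ... | j , Uj , e∈Aj with i ≟ j
  ...   | no i≢j with ∨-true⁻ {I j} Uj
  ...     | inj₁ Ij = ∈-++⁺ˡ (∈-⋃⁺ _ I j Ij (subst (_ ∈_) (sym (updateAt-minimal j i A (i≢j ∘ sym))) e∈Aj))
  ...     | inj₂ Jj = ∈-++⁺ʳ _ (∈-⋃⁺ _ J j Jj (subst (_ ∈_) (sym (updateAt-minimal j i A (i≢j ∘ sym))) e∈Aj))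
  ⋃-∪-⊆ A i Ai≡ I J Ii Ji e∈ | j , Uj , e∈Aj | yes refl with subst (_ ∈_) Ai≡ e∈Aj
  ... | here e≡x   = ∈-++⁺ʳ _ (∈-⋃⁺ _ J i Ji (subst (_ ∈_) (sym (updateAt-updates i A)) (here e≡x)))
  ... | there e∈yr = ∈-++⁺ˡ (∈-⋃⁺ _ I i Ii (subst (_ ∈_) (sym (updateAt-updates i A)) e∈yr))

  -- Rado's exchange argument: if A i = x ∷ y ∷ r, dropping x or dropping y keeps the condition.
  -- Violators I (without x) and J (without y) would give, by submodularity applied to the unions
  -- over I ∪ J and over (I ∩ J) ∖ {i} together with r, the impossible 2 (size P + 1) ≤ 2 size P + 1.
  exchange : ∀ {N} (A : Fin N → List (Edge n)) i {x y r} → A i ≡ x ∷ y ∷ r → RadoCondition A →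
             ∀ I J → ¬ RadoSet (A [ i ]≔ (y ∷ r)) I → ¬ RadoSet (A [ i ]≔ (x ∷ r)) J → ⊥
  exchange {N} A i {x} {y} {r} Ai≡ cond I J violI violJ = 1+n≰n (≤-pred (begin
    suc (suc (k + k))                        ≡⟨ double k ⟩
    suc k + suc k                            ≤⟨ +-mono-≤ (≰⇒> violI) (≰⇒> violJ) ⟩
    ∣ I ∣ + σ X + (∣ J ∣ + σ Y)              ≡⟨ interchange (∣ I ∣) (σ X) (∣ J ∣) (σ Y) ⟩
    ∣ I ∣ + ∣ J ∣ + (σ X + σ Y)              ≤⟨ +-mono-≤ (≤-reflexive (sym (inclusion-exclusion I J i Ii Ji)))
                                                        (size-submodular P W⊆X W⊆Y (⋃-∪-⊆ A i Ai≡ I J Ii Ji)) ⟩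
    ∣ I ∪ J ∣ + ∣ C ∣ + 1 + (σ Z + σ W)      ≡⟨ regroup (∣ I ∪ J ∣) (∣ C ∣) (σ Z) (σ W) ⟩
    suc (∣ I ∪ J ∣ + σ Z + (∣ C ∣ + σ W))    ≤⟨ s≤s (+-mono-≤ (cond (I ∪ J)) (≤-trans (+-monoʳ-≤ (∣ C ∣) W≤C) (cond C))) ⟩
    suc (k + k)                              ∎))
    where
    open ≤-Reasoning
    k = size P
    σ : List (Edge n) → ℕ
    σ L = size (joinAll P L)
    C = I ∩ (J ∩ ∁ ⁅ i ⁆)
    X = ⋃ (A [ i ]≔ (y ∷ r)) I
    Y = ⋃ (A [ i ]≔ (x ∷ r)) J
    Z = ⋃ A (I ∪ J)
    W = ⋃ A C ++ r
    Ii : I i ≡ true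
    Ii = violator-contains A i _ I cond violI
    Ji : J i ≡ true
    Ji = violator-contains A i _ J cond violJ
    W≤C : σ W ≤ σ (⋃ A C)
    W≤C = size-antitone P {⋃ A C} {W} ∈-++⁺ˡ
    C-parts : ∀ {j} → C j ≡ true → I j ≡ true × J j ≡ true × i ≢ j
    C-parts {j} Cj with ∧-true⁻ {I j} Cj
    ... | Ij , rest with ∧-true⁻ {J j} rest
    ...   | Jj , j∉⁅i⁆ = Ij , Jj , ∉⁅⁆ j∉⁅i⁆
    W⊆X : W ⊆ X
    W⊆X = ⋃-update-⊇ A i C I Ii there (λ Cj → proj₁ (C-parts Cj) , proj₂ (proj₂ (C-parts Cj)))
    W⊆Y : W ⊆ Y
    W⊆Y = ⋃-update-⊇ A i C J Ji there (proj₂ ∘ C-parts)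
    double : ∀ k → suc (suc (k + k)) ≡ suc k + suc k
    double = solve-∀
    interchange : ∀ a b c d → a + b + (c + d) ≡ a + c + (b + d)
    interchange = solve-∀
    regroup : ∀ a b c d → a + b + 1 + (c + d) ≡ suc (a + c + (b + d))
    regroup = solve-∀

  update-⊆ : ∀ {N} (A : Fin N → List (Edge n)) i L → L ⊆ A i → ∀ j → (A [ i ]≔ L) j ⊆ A j
  update-⊆ A i L L⊆Ai j with i ≟ j
  ... | yes refl = L⊆Ai ∘ subst (_ ∈_) (updateAt-updates i A)
  ... | no i≢j   = subst (_ ∈_) (updateAt-minimal j i A (i≢j ∘ sym))

  update-shorter : ∀ {N} (A : Fin N → List (Edge n)) i {x y r} → A i ≡ x ∷ y ∷ r → ∀ z →
                   ∑ (length ∘ (A [ i ]≔ (z ∷ r))) < ∑ (length ∘ A)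
  update-shorter A i {x} {y} {r} Ai≡ z =
    ∑-mono-< pointwise i (subst₂ _<_ (cong length (sym (updateAt-updates i A))) (cong length (sym Ai≡)) ≤-refl)
    where
    pointwise : ∀ j → length ((A [ i ]≔ (z ∷ r)) j) ≤ length (A j)
    pointwise j with i ≟ j
    ... | yes refl = subst₂ _≤_ (cong length (sym (updateAt-updates i A))) (cong length (sym Ai≡)) (n≤1+n _)
    ... | no i≢j   = ≤-reflexive (cong length (updateAt-minimal j i A (i≢j ∘ sym)))

  rado : ∀ {N} (A : Fin N → List (Edge n)) → RadoCondition A → IndependentTransversal A
  rado A = go _ A ≤-refl
    where
    go : ∀ bound {N} (A : Fin N → List (Edge n)) → ∑ (length ∘ A) ≤ bound → RadoCondition A → IndependentTransversal A
    shrink : ∀ bound {N} (A : Fin N → List (Edge n)) → ∑ (length ∘ A) ≤ bound → RadoCondition A →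
             ∀ i → 2 ≤ length (A i) → IndependentTransversal A

    go bound A ≤bound cond with any? (λ i → 2 ≤? length (A i))
    ... | no none        = transversal-of-short A (λ i 2≤ → none (i , 2≤)) cond
    ... | yes (i , 2≤)   = shrink bound A ≤bound cond i 2≤

    shrink zero A ≤bound cond i 2≤ with ≤-trans 2≤ (≤-trans (≤-∑ (length ∘ A) i) ≤bound)
    ... | ()
    shrink (suc bound) A ≤bound cond i 2≤ with A i in Ai≡ | 2≤
    ... | _ ∷ []    | s≤s ()
    ... | x ∷ y ∷ r | _
      with all-subsets? _ (RadoSet (A [ i ]≔ (y ∷ r))) (RadoSet? _) (RadoSet-resp _)
    ...   | inj₁ cond′ =
            transversal-⊆ A _ (update-⊆ A i _ (⊆-trans (xs⊆x∷xs _ x) (⊆-reflexive (sym Ai≡))))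
              (go bound _ (≤-pred (≤-trans (update-shorter A i Ai≡ y) ≤bound)) cond′)
    ...   | inj₂ (I , violI)
      with all-subsets? _ (RadoSet (A [ i ]≔ (x ∷ r))) (RadoSet? _) (RadoSet-resp _)
    ...     | inj₁ cond″ =
              transversal-⊆ A _ (update-⊆ A i _ (⊆-trans (∷⁺ʳ x (xs⊆x∷xs r y)) (⊆-reflexive (sym Ai≡))))
                (go bound _ (≤-pred (≤-trans (update-shorter A i Ai≡ x) ≤bound)) cond″)
    ...     | inj₂ (J , violJ) = ⊥-elim (exchange A i Ai≡ cond I J violI violJ)

module _ {n : ℕ} {A : Adj n} where

  walk-++ : ∀ {u w v} → Walk A u w → Walk A w v → Walk A u v
  walk-++ here       q = q
  walk-++ (step a p) q = step a (walk-++ p q)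

  walk-reverse : (∀ x y → A x y ≡ A y x) → ∀ {u v} → Walk A u v → Walk A v u
  walk-reverse A-sym here               = here
  walk-reverse A-sym (step {u} {w} a p) = walk-++ (walk-reverse A-sym p) (step (trans (A-sym w u) a) here)

  walk-length : ∀ {u v} → Walk A u v → ℕ
  walk-length here       = 0
  walk-length (step _ p) = suc (walk-length p)

  vertex : ∀ {u v} (p : Walk A u v) → Fin (suc (walk-length p)) → Fin n
  vertex {u} p          zero    = u
  vertex     (step _ p) (suc i) = vertex p i

  vertex-last : ∀ {u v} (p : Walk A u v) → vertex p (fromℕ (walk-length p)) ≡ v
  vertex-last here       = refl
  vertex-last (step _ p) = vertex-last p

  vertex-adjacent : ∀ {u v} (p : Walk A u v) (i : Fin (walk-length p)) → A (vertex p (inject₁ i)) (vertex p (suc i)) ≡ true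
  vertex-adjacent (step a here)       zero    = a
  vertex-adjacent (step a (step _ _)) zero    = a
  vertex-adjacent (step _ p)          (suc i) = vertex-adjacent p i

  Simple : ∀ {u v} → Walk A u v → Set
  Simple here           = ⊤
  Simple (step {u} _ p) = (∀ i → vertex p i ≢ u) × Simple p

  vertex-injective : ∀ {u v} (p : Walk A u v) → Simple p → ∀ {i j} → vertex p i ≡ vertex p j → i ≡ j
  vertex-injective p          _              {zero}  {zero}  _  = refl
  vertex-injective (step _ p) (fresh , _)    {zero}  {suc j} eq = ⊥-elim (fresh j (sym eq))
  vertex-injective (step _ p) (fresh , _)    {suc i} {zero}  eq = ⊥-elim (fresh i eq)
  vertex-injective (step _ p) (_ , simple)   {suc i} {suc j} eq = cong suc (vertex-injective p simple eq)

  SimpleWalk : Fin n → Fin n → Set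
  SimpleWalk u v = Σ (Walk A u v) Simple

  simple-suffix : ∀ {u v} (p : Walk A u v) → Simple p → ∀ i → SimpleWalk (vertex p i) v
  simple-suffix p          simple       zero    = p , simple
  simple-suffix (step _ p) (_ , simple) (suc i) = simple-suffix p simple i

  simplify : ∀ {u v} → Walk A u v → SimpleWalk u v
  simplify here = here , tt
  simplify {u} (step a p) with simplify p
  ... | p′ , simple with any? (λ i → vertex p′ i ≟ u)
  ...   | no fresh     = step a p′ , (λ i eq → fresh (i , eq)) , simple
  ...   | yes (i , eq) = subst (λ x → SimpleWalk x _) eq (simple-suffix p′ simple i)

  simple-closed-walk⇒cycle : ∀ {B : Adj n} → (∀ {x y} → A x y ≡ true → B x y ≡ true) →
                             ∀ {u v} (p : Walk A u v) → Simple p → 2 ≤ walk-length p → B v u ≡ true → Cycle B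
  simple-closed-walk⇒cycle A⇒B (step _ here) _ (s≤s ()) _
  simple-closed-walk⇒cycle {B} A⇒B {u} p@(step _ (step _ q)) simple _ closing =
    walk-length q , vertex p , vertex-injective p simple , A⇒B ∘ vertex-adjacent p ,
    subst (λ x → B x u ≡ true) (sym (vertex-last p)) closing

module _ {n : ℕ} where

  _≟ᴱ_ : (d e : Edge n) → Dec (d ≡ e)
  _≟ᴱ_ = ≡-dec _≟_ _≟_

  open DecMembership _≟ᴱ_ using (_∈?_; _∉?_)

  _∈±_ : Edge n → List (Edge n) → Set
  (x , y) ∈± L = (x , y) ∈ L ⊎ (y , x) ∈ L

  edgeAdj : List (Edge n) → Adj n
  edgeAdj L x y = does ((x , y) ∈? L) ∨ does ((y , x) ∈? L)

  edgeAdj-sym : ∀ L x y → edgeAdj L x y ≡ edgeAdj L y x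
  edgeAdj-sym L x y = ∨-comm (does ((x , y) ∈? L)) (does ((y , x) ∈? L))

  edgeAdj⁺ : ∀ {L x y} → (x , y) ∈± L → edgeAdj L x y ≡ true
  edgeAdj⁺ {L} {x} {y} (inj₁ xy∈) with (x , y) ∈? L
  ... | yes _   = refl
  ... | no xy∉  = ⊥-elim (xy∉ xy∈)
  edgeAdj⁺ {L} {x} {y} (inj₂ yx∈) with (y , x) ∈? L
  ... | yes _   = ∨-zeroʳ (does ((x , y) ∈? L))
  ... | no yx∉  = ⊥-elim (yx∉ yx∈)

  edgeAdj⁻ : ∀ {L x y} → edgeAdj L x y ≡ true → (x , y) ∈± L
  edgeAdj⁻ {L} {x} {y} adj with (x , y) ∈? L | (y , x) ∈? L
  ... | yes xy∈ | _      = inj₁ xy∈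
  ... | no _    | yes yx∈ = inj₂ yx∈

  linked⇒walk : ∀ (A : Adj n) L → (∀ x y → A x y ≡ A y x) → (∀ {u v} → (u , v) ∈ L → A u v ≡ true) →
                ∀ {x y} → Linked discrete L x y → Walk A x y
  linked⇒walk A L A-sym L⊆A (same refl) = here
  linked⇒walk A L A-sym L⊆A (edge e∈)   = step (L⊆A e∈) here
  linked⇒walk A L A-sym L⊆A (inv p)     = walk-reverse A-sym (linked⇒walk A L A-sym L⊆A p)
  linked⇒walk A L A-sym L⊆A (p ∙ q)     = walk-++ (linked⇒walk A L A-sym L⊆A p) (linked⇒walk A L A-sym L⊆A q)

  walk⇒linked : ∀ (A : Adj n) L → (∀ {u v} → A u v ≡ true → (u , v) ∈± L) → ∀ {x y} → Walk A x y → Linked discrete L x y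
  walk⇒linked A L A⊆L here = same refl
  walk⇒linked A L A⊆L (step a p) with A⊆L a
  ... | inj₁ e∈ = edge e∈ ∙ walk⇒linked A L A⊆L p
  ... | inj₂ e∈ = inv (edge e∈) ∙ walk⇒linked A L A⊆L p

  edges⇒components : ∀ (A : Adj n) L → (∀ x y → A x y ≡ A y x) → (∀ {u v} → (u , v) ∈ L → A u v ≡ true) →
                     (∀ {u v} → A u v ≡ true → (u , v) ∈± L) → HasComponents A (size (joinAll discrete L))
  edges⇒components A L A-sym L⊆A A⊆L =
    block (joinAll discrete L) ,
    (λ b → proj₁ (block-onto (joinAll discrete L) b) , λ x≡ → trans (cong _ x≡) (proj₂ (block-onto (joinAll discrete L) b))) ,
    λ u v → mk⇔ (linked⇒walk A L A-sym L⊆A ∘ sameBlock⇒linked discrete L u v)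
                (linked⇒sameBlock discrete L ∘ walk⇒linked A L A⊆L)

  Unique-++-∉ : ∀ (P : List (Edge n)) {e L} → Unique (P ++ e ∷ L) → e ∉ P
  Unique-++-∉ (d ∷ P) (d≢ ∷ _)     (here refl) = All.lookup d≢ (∈-++⁺ʳ P (here refl)) refl
  Unique-++-∉ (d ∷ P) (_ ∷ unique) (there e∈P) = Unique-++-∉ P unique e∈P

  OrientedEdgesOf : Graph n → List (Edge n) → Set
  OrientedEdgesOf F L = ∀ {u v} → (u , v) ∈ L → toℕ u < toℕ v × adj F u v ≡ true

  -- A shortest link from a to b would be the edge (a , b) itself, or reversed, or would close a cycle.
  forest-edge-unlinked : ∀ (F : Graph n) → Forest F → ∀ P {a b} → OrientedEdgesOf F P → (a , b) ∉ P →
                         toℕ a < toℕ b → adj F b a ≡ true → ¬ Linked discrete P a b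
  forest-edge-unlinked F forest P oriented ab∉P a<b Fba linked
    with simplify (linked⇒walk (edgeAdj P) P (edgeAdj-sym P) (edgeAdj⁺ ∘ inj₁) linked)
  ... | here , _ = <-irrefl refl a<b
  ... | step e here , _ with edgeAdj⁻ {P} e
  ...   | inj₁ ab∈P = ab∉P ab∈P
  ...   | inj₂ ba∈P = <-asym a<b (proj₁ (oriented ba∈P))
  forest-edge-unlinked F forest P oriented ab∉P a<b Fba linked | p@(step _ (step _ _)) , simple =
    forest (simple-closed-walk⇒cycle toF p simple (s≤s (s≤s z≤n)) Fba)
    where
    toF : ∀ {x y} → edgeAdj P x y ≡ true → adj F x y ≡ true
    toF {x} {y} e with edgeAdj⁻ {P} e
    ... | inj₁ xy∈ = proj₂ (oriented xy∈)
    ... | inj₂ yx∈ = trans (Graph.sym F x y) (proj₂ (oriented yx∈))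

  forest⇒independent : ∀ (F : Graph n) → Forest F → ∀ L → Unique L → OrientedEdgesOf F L →
                       merges discrete L ≡ length L
  forest⇒independent F forest = from []
    where
    from : ∀ P L → Unique (P ++ L) → OrientedEdgesOf F (P ++ L) → merges (joinAll discrete P) L ≡ length L
    from P []            unique oriented = refl
    from P ((a , b) ∷ L) unique oriented = cong₂ _+_ gain≡1 rest
      where
      Q = joinAll discrete P
      oriented-ab = oriented (∈-++⁺ʳ P (here refl))
      gain≡1 : gain Q (a , b) ≡ 1
      gain≡1 with block Q a ≟ block Q b
      ... | no _    = refl
      ... | yes eq  = ⊥-elim (forest-edge-unlinked F forest P (oriented ∘ ∈-++⁺ˡ) (Unique-++-∉ P unique)
                        (proj₁ oriented-ab) (trans (Graph.sym F b a) (proj₂ oriented-ab)) (sameBlock⇒linked discrete P a b eq))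
      rest : merges (join Q (a , b)) L ≡ length L
      rest = subst (λ R → merges R L ≡ length L) (joinAll-++ discrete P [ (a , b) ])
               (from (P ++ [ (a , b) ]) L (subst Unique (sym (++-assoc P _ L)) unique)
                     (oriented ∘ subst (_ ∈_) (++-assoc P _ L)))

  ω≤-joinAll : ∀ (A : Adj n) L → (∀ x y → A x y ≡ A y x) → (∀ {u v} → (u , v) ∈ L → A u v ≡ true) →
               ω≤ A (size (joinAll discrete L))
  ω≤-joinAll A L A-sym L⊆A k (component , onto , walk⇔) =
    onto-coarsening⇒≤ (block (joinAll discrete L)) component (λ b → proj₁ (onto b) , proj₂ (onto b) refl)
      (λ x y eq → Equivalence.from (walk⇔ x y) (linked⇒walk A L A-sym L⊆A (sameBlock⇒linked discrete L x y eq)))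

  independent-minimal : ∀ (L L′ : List (Edge n)) → merges discrete L ≡ length L →
                        (∀ {x y} → Linked discrete L x y → Linked discrete L′ x y) → length L ≤ length L′
  independent-minimal L L′ independent L⇒L′ = +-cancelʳ-≤ (size (joinAll discrete L)) _ _ (begin
    length L + size (joinAll discrete L)         ≡⟨ cong (_+ size (joinAll discrete L)) independent ⟨
    merges discrete L + size (joinAll discrete L) ≡⟨ size-joinAll discrete L ⟨
    size discrete                                ≡⟨ size-joinAll discrete L′ ⟩
    merges discrete L′ + size (joinAll discrete L′) ≤⟨ +-mono-≤ (merges≤length discrete L′) (Linked-⇒-size-≤ discrete L discrete L′ L⇒L′) ⟩
    length L′ + size (joinAll discrete L)        ∎)
    where open ≤-Reasoning

  -- Deleting the closing edge of a cycle (in both orientations) keeps its endpoints linked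
  -- along the rest of the cycle.
  independent⇒acyclic : ∀ L → merges discrete L ≡ length L → ¬ Cycle (edgeAdj L)
  independent⇒acyclic L independent (k , vs , vs-injective , adjacent , closing) =
    1+n≰n (≤-trans shorter (independent-minimal L L′ independent L⇒L′))
    where
    first = vs zero
    last  = vs (fromℕ (2 + k))
    closing-edges = (last , first) ∷ (first , last) ∷ []
    L′ = filter (_∉? closing-edges) L
    inject₁≢ : ∀ (i : Fin (2 + k)) → inject₁ i ≡ zero → suc i ≢ fromℕ (2 + k)
    inject₁≢ zero _ ()
    not-closing : ∀ i {x y} → (x , y) ∈± ((vs (inject₁ i) , vs (suc i)) ∷ []) → (x , y) ∉ closing-edges
    not-closing i (inj₁ (here refl)) (here eq)            = fromℕ≢inject₁ (sym (vs-injective (cong proj₁ eq)))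
    not-closing i (inj₁ (here refl)) (there (here eq))    = inject₁≢ i (vs-injective (cong proj₁ eq)) (vs-injective (cong proj₂ eq))
    not-closing i (inj₂ (here refl)) (here eq)            = inject₁≢ i (vs-injective (cong proj₂ eq)) (vs-injective (cong proj₁ eq))
    not-closing i (inj₂ (here refl)) (there (here eq)) with vs-injective (cong proj₁ eq)
    ... | ()
    cycle-step : ∀ i → Linked discrete L′ (vs (inject₁ i)) (vs (suc i))
    cycle-step i with edgeAdj⁻ {L} (adjacent i)
    ... | inj₁ e∈ = edge (∈-filter⁺ (_∉? closing-edges) e∈ (not-closing i (inj₁ (here refl))))
    ... | inj₂ e∈ = inv (edge (∈-filter⁺ (_∉? closing-edges) e∈ (not-closing i (inj₂ (here refl)))))
    along : ∀ m (w : Fin (suc m) → Fin n) → (∀ i → Linked discrete L′ (w (inject₁ i)) (w (suc i))) →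
            Linked discrete L′ (w zero) (w (fromℕ m))
    along zero    w steps = same refl
    along (suc m) w steps = steps zero ∙ along m (w ∘ suc) (steps ∘ suc)
    L⇒L′ : ∀ {x y} → Linked discrete L x y → Linked discrete L′ x y
    L⇒L′ = Linked-map same kept
      where
      kept : ∀ {x y} → (x , y) ∈ L → Linked discrete L′ x y
      kept {x} {y} e∈ with (x , y) ∈? closing-edges
      ... | no e∉                    = edge (∈-filter⁺ (_∉? closing-edges) e∈ e∉)
      ... | yes (here refl)          = inv (along (2 + k) vs cycle-step)
      ... | yes (there (here refl))  = along (2 + k) vs cycle-step
    shorter : suc (length L′) ≤ length L
    shorter with edgeAdj⁻ {L} closing
    ... | inj₁ e∈ = filter-notAll (_∉? closing-edges) L (lose e∈ (λ e∉ → e∉ (here refl)))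
    ... | inj₂ e∈ = filter-notAll (_∉? closing-edges) L (lose e∈ (λ e∉ → e∉ (there (here refl))))

lt-sound : ∀ {n} {u v : Fin n} → lt u v ≡ true → toℕ u < toℕ v
lt-sound {u = u} {v} _ with toℕ u <? toℕ v
... | yes u<v = u<v

lt-complete : ∀ {n} {u v : Fin n} → toℕ u < toℕ v → lt u v ≡ true
lt-complete {u = u} {v} u<v with toℕ u <? toℕ v
... | yes _   = refl
... | no u≮v = ⊥-elim (u≮v u<v)

isColor≡does : ∀ {r} (a b : Fin r) → isColor a b ≡ does (a ≟ b)
isColor≡does a b with a ≟ b
... | yes _ = refl
... | no _  = refl

removeColors-sym : ∀ {n r} (G : Graph n) (col : Coloring n r) → (∀ u v → col u v ≡ col v u) →
                   ∀ R x y → removeColors G col R x y ≡ removeColors G col R y x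
removeColors-sym G col col-sym R x y = cong₂ _∧_ (Graph.sym G x y) (cong (not ∘ R) (col-sym x y))

module _ {n r : ℕ} (col : Coloring n r) where

  ∑in-colorCount : ∀ (F : Graph n) (S : Fin r → Bool) →
                   ∑in S (colorCount F col) ≡ ∑ (λ u → ∑ (λ v → ⟦ lt u v ∧ (adj F u v ∧ S (col u v)) ⟧))
  ∑in-colorCount F S = begin
    ∑ (λ c → if S c then ∑ (λ u → ∑ (λ v → e u v c)) else 0)   ≡⟨ ∑-cong (λ c → sym (push-if (S c))) ⟩
    ∑ (λ c → ∑ (λ u → ∑ (λ v → if S c then e u v c else 0)))   ≡⟨ ∑-comm (λ c u → ∑ (λ v → if S c then e u v c else 0)) ⟩
    ∑ (λ u → ∑ (λ c → ∑ (λ v → if S c then e u v c else 0)))   ≡⟨ ∑-cong (λ u → ∑-comm (λ c v → if S c then e u v c else 0)) ⟩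
    ∑ (λ u → ∑ (λ v → ∑ (λ c → if S c then e u v c else 0)))   ≡⟨ ∑-cong (λ u → ∑-cong (λ v → select-color (col u v) (lt u v) (adj F u v))) ⟩
    ∑ (λ u → ∑ (λ v → ⟦ lt u v ∧ (adj F u v ∧ S (col u v)) ⟧))   ∎
    where
    open ≡-Reasoning
    e : Fin n → Fin n → Fin r → ℕ
    e u v c = ⟦ lt u v ∧ (adj F u v ∧ isColor (col u v) c) ⟧
    push-if : ∀ b {g : Fin n → Fin n → ℕ} → ∑ (λ u → ∑ (λ v → if b then g u v else 0)) ≡ (if b then ∑ (λ u → ∑ (g u)) else 0)
    push-if true  = refl
    push-if false = trans (∑-cong {n} {λ _ → ∑ {n} (λ _ → 0)} (λ _ → ∑-zero n)) (∑-zero n)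
    select-color : ∀ x l a → ∑ (λ c → if S c then ⟦ l ∧ (a ∧ isColor x c) ⟧ else 0) ≡ ⟦ l ∧ (a ∧ S x) ⟧
    select-color x l a = trans (∑-cong term) (∑-select x (λ c → ⟦ l ∧ (a ∧ S c) ⟧))
      where
      term : ∀ c → (if S c then ⟦ l ∧ (a ∧ isColor x c) ⟧ else 0) ≡ (if does (x ≟ c) then ⟦ l ∧ (a ∧ S c) ⟧ else 0)
      term c rewrite isColor≡does x c with x ≟ c | S c
      ... | yes _ | true  = refl
      ... | yes _ | false = cong ⟦_⟧ (sym (trans (cong (l ∧_) (∧-zeroʳ a)) (∧-zeroʳ l)))
      ... | no _  | true  = cong ⟦_⟧ (trans (cong (l ∧_) (∧-zeroʳ a)) (∧-zeroʳ l))
      ... | no _  | false = refl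

  forest⇒component-bound : ∀ (m : ℕ) (f : Fin r → ℕ) (G : Graph n) → (∀ u v → col u v ≡ col v u) → ∑ f + m ≡ n →
                           ∀ (F : Graph n) → SpanningSubgraph F G → Forest F → (∀ c → colorCount F col c ≡ f c) →
                           ∀ R → ω≤ (removeColors G col R) (m + ∑in R f)
  forest⇒component-bound m f G col-sym ∑f+m≡n F F⊆G forest counts R =
    subst (ω≤ (removeColors G col R)) size≡ (ω≤-joinAll _ L (removeColors-sym G col col-sym R) L⊆G-R)
    where
    kept : Fin n → Fin n → Bool
    kept u v = lt u v ∧ (adj F u v ∧ not (R (col u v)))
    L = edgesOf kept
    kept⁻ : ∀ {u v} → (u , v) ∈ L → toℕ u < toℕ v × adj F u v ≡ true × not (R (col u v)) ≡ true
    kept⁻ {u} {v} e∈ with ∧-true⁻ {lt u v} (∈-edgesOf⁻ kept e∈)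
    ... | lt≡ , rest = lt-sound lt≡ , ∧-true⁻ rest
    L⊆G-R : ∀ {u v} → (u , v) ∈ L → removeColors G col R u v ≡ true
    L⊆G-R {u} {v} e∈ = ∧-true⁺ (F⊆G u v (proj₁ (proj₂ (kept⁻ e∈)))) (proj₂ (proj₂ (kept⁻ e∈)))
    length-L : length L ≡ ∑in (not ∘ R) f
    length-L = begin
      length L                              ≡⟨ length-edgesOf kept ⟩
      ∑ (λ u → ∑ (λ v → ⟦ kept u v ⟧))      ≡⟨ ∑in-colorCount F (not ∘ R) ⟨
      ∑in (not ∘ R) (colorCount F col)      ≡⟨ ∑-cong (λ c → cong (λ t → if not (R c) then t else 0) (counts c)) ⟩
      ∑in (not ∘ R) f                       ∎
      where open ≡-Reasoning
    independent : merges discrete L ≡ length L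
    independent = forest⇒independent F forest L (edgesOf-unique kept) (λ e∈ → proj₁ (kept⁻ e∈) , proj₁ (proj₂ (kept⁻ e∈)))
    size≡ : size (joinAll discrete L) ≡ m + ∑in R f
    size≡ = +-cancelˡ-≡ (∑in (not ∘ R) f) _ _ (begin
      ∑in (not ∘ R) f + size (joinAll discrete L)  ≡⟨ cong (_+ size (joinAll discrete L)) (trans independent length-L) ⟨
      merges discrete L + size (joinAll discrete L) ≡⟨ size-joinAll discrete L ⟨
      n                                             ≡⟨ ∑f+m≡n ⟨
      ∑ f + m                                       ≡⟨ cong (_+ m) (∑in-complement R f) ⟨
      ∑in R f + ∑in (not ∘ R) f + m                 ≡⟨ rearrange (∑in R f) (∑in (not ∘ R) f) m ⟩
      ∑in (not ∘ R) f + (m + ∑in R f)               ∎)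
      where
      open ≡-Reasoning
      rearrange : ∀ a b c → a + b + c ≡ b + (c + a)
      rearrange = solve-∀

independent-injective : ∀ {n N} (a : Fin N → Edge n) → merges discrete (edgeList a) ≡ N → ∀ {i j} → a i ≡ a j → i ≡ j
independent-injective {N = suc N} a independent {i} {j} ai≡aj with i ≟ j
... | yes i≡j = i≡j
... | no i≢j  = ⊥-elim (1+n≰n (subst₂ _≤_ (length-edgeList a) (length-edgeList a′)
                  (independent-minimal (edgeList a) (edgeList a′) (trans independent (sym (length-edgeList a)))
                                       (Linked-map same covered))))
  where
  a′ = a ∘ punchIn j
  ∈a′ : ∀ t → j ≢ t → a t ∈ edgeList a′
  ∈a′ t j≢t = subst (_∈ edgeList a′) (cong a (punchIn-punchOut j≢t)) (∈-edgeList⁺ a′ (punchOut j≢t))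
  covered : ∀ {x y} → (x , y) ∈ edgeList a → Linked discrete (edgeList a′) x y
  covered e∈ with ∈-edgeList⁻ a e∈
  ... | t , e≡at with j ≟ t
  ...   | yes refl = edge (subst (_∈ edgeList a′) (sym (trans e≡at (sym ai≡aj))) (∈a′ i (i≢j ∘ sym)))
  ...   | no j≢t   = edge (subst (_∈ edgeList a′) (sym e≡at) (∈a′ t j≢t))

module _ {n : ℕ} where

  edgeGraph : (L : List (Edge n)) → (∀ {u v} → (u , v) ∈ L → toℕ u < toℕ v) → Graph n
  edgeGraph L oriented = record { adj = edgeAdj L ; sym = edgeAdj-sym L ; irrefl = loopless }
    where
    loopless : ∀ v → edgeAdj L v v ≡ false
    loopless v with edgeAdj L v v in vv
    ... | false = refl
    ... | true with edgeAdj⁻ {L = L} vv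
    ...   | inj₁ vv∈ = ⊥-elim (<-irrefl refl (oriented vv∈))
    ...   | inj₂ vv∈ = ⊥-elim (<-irrefl refl (oriented vv∈))

  at : Edge n → Fin n → Fin n → ℕ → ℕ
  at (x , y) u v t = if does (x ≟ u) then (if does (y ≟ v) then t else 0) else 0

  ∑∑-at : ∀ e (h : Fin n → Fin n → ℕ) → ∑ (λ u → ∑ (λ v → at e u v (h u v))) ≡ h (proj₁ e) (proj₂ e)
  ∑∑-at (x , y) h =
    trans (∑-cong (λ u → ∑-if (does (x ≟ u)) (λ v → if does (y ≟ v) then h u v else 0)))
          (trans (∑-select x (λ u → ∑ (λ v → if does (y ≟ v) then h u v else 0))) (∑-select y (h x)))

  at-self : ∀ u v t → at (u , v) u v t ≡ t
  at-self u v t rewrite does-≟-refl u | does-≟-refl v = refl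

  at-other : ∀ e u v t → e ≢ (u , v) → at e u v t ≡ 0
  at-other (x , y) u v t e≢ with x ≟ u | y ≟ v
  ... | yes refl | yes refl = ⊥-elim (e≢ refl)
  ... | yes _    | no _     = refl
  ... | no _     | _        = refl

  edge-indicator : ∀ {N} (a : Fin N → Edge n) → (∀ {i j} → a i ≡ a j → i ≡ j) →
                   (∀ i → toℕ (proj₁ (a i)) < toℕ (proj₂ (a i))) → ∀ u v b →
                   ⟦ lt u v ∧ (edgeAdj (edgeList a) u v ∧ b) ⟧ ≡ ∑ (λ i → at (a i) u v ⟦ b ⟧)
  edge-indicator {N} a injective oriented u v b with any? (λ i → a i ≟ᴱ (u , v))
  ... | yes (i₀ , ai₀≡) = begin
    ⟦ lt u v ∧ (edgeAdj (edgeList a) u v ∧ b) ⟧ ≡⟨ cong (λ l → ⟦ l ∧ (edgeAdj (edgeList a) u v ∧ b) ⟧) lt≡ ⟩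
    ⟦ edgeAdj (edgeList a) u v ∧ b ⟧             ≡⟨ cong (λ e → ⟦ e ∧ b ⟧) adj≡ ⟩
    ⟦ b ⟧                                       ≡⟨ ∑-select i₀ (λ _ → ⟦ b ⟧) ⟨
    ∑ (λ i → if does (i₀ ≟ i) then ⟦ b ⟧ else 0) ≡⟨ ∑-cong only-i₀ ⟩
    ∑ (λ i → at (a i) u v ⟦ b ⟧)                 ∎
    where
    open ≡-Reasoning
    lt≡ : lt u v ≡ true
    lt≡ = lt-complete (subst (λ e → toℕ (proj₁ e) < toℕ (proj₂ e)) ai₀≡ (oriented i₀))
    adj≡ : edgeAdj (edgeList a) u v ≡ true
    adj≡ = edgeAdj⁺ (inj₁ (subst (_∈ edgeList a) ai₀≡ (∈-edgeList⁺ a i₀)))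
    only-i₀ : ∀ i → (if does (i₀ ≟ i) then ⟦ b ⟧ else 0) ≡ at (a i) u v ⟦ b ⟧
    only-i₀ i with i₀ ≟ i
    ... | yes refl = sym (subst (λ e → at e u v ⟦ b ⟧ ≡ ⟦ b ⟧) (sym ai₀≡) (at-self u v ⟦ b ⟧))
    ... | no i₀≢i  = sym (at-other (a i) u v ⟦ b ⟧ (λ ai≡ → i₀≢i (injective (trans ai₀≡ (sym ai≡)))))
  ... | no none = trans absent (sym (trans (∑-cong (λ i → at-other (a i) u v ⟦ b ⟧ (λ ai≡ → none (i , ai≡)))) (∑-zero N)))
    where
    absent : ⟦ lt u v ∧ (edgeAdj (edgeList a) u v ∧ b) ⟧ ≡ 0
    absent with lt u v in lt≡ | edgeAdj (edgeList a) u v in adj≡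
    ... | false | _     = refl
    ... | true  | false = refl
    ... | true  | true with edgeAdj⁻ {L = edgeList a} adj≡
    ...   | inj₁ uv∈ = ⊥-elim (none (map₂ sym (∈-edgeList⁻ a uv∈)))
    ...   | inj₂ vu∈ with ∈-edgeList⁻ a vu∈
    ...     | i , vu≡ = ⊥-elim (<-asym (lt-sound lt≡) (subst (λ e → toℕ (proj₁ e) < toℕ (proj₂ e)) (sym vu≡) (oriented i)))

  oriented-edgeList : ∀ {N} (a : Fin N → Edge n) → (∀ i → toℕ (proj₁ (a i)) < toℕ (proj₂ (a i))) →
                      ∀ {u v} → (u , v) ∈ edgeList a → toℕ u < toℕ v
  oriented-edgeList a oriented e∈ with ∈-edgeList⁻ a e∈
  ... | i , refl = oriented i

  colorCount-edgeGraph : ∀ {r} (col : Coloring n r) {N} (a : Fin N → Edge n) (injective : ∀ {i j} → a i ≡ a j → i ≡ j)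
                         (oriented : ∀ i → toℕ (proj₁ (a i)) < toℕ (proj₂ (a i))) c →
                         colorCount (edgeGraph (edgeList a) (oriented-edgeList a oriented)) col c
                         ≡ ∑ (λ i → ⟦ isColor (col (proj₁ (a i)) (proj₂ (a i))) c ⟧)
  colorCount-edgeGraph col a injective oriented c = begin
    ∑ (λ u → ∑ (λ v → ⟦ lt u v ∧ (edgeAdj (edgeList a) u v ∧ colorIs u v) ⟧))
      ≡⟨ ∑-cong (λ u → ∑-cong (λ v → edge-indicator a injective oriented u v (colorIs u v))) ⟩
    ∑ (λ u → ∑ (λ v → ∑ (λ i → at (a i) u v ⟦ colorIs u v ⟧)))
      ≡⟨ ∑-cong (λ u → ∑-comm (λ v i → at (a i) u v ⟦ colorIs u v ⟧)) ⟩
    ∑ (λ u → ∑ (λ i → ∑ (λ v → at (a i) u v ⟦ colorIs u v ⟧)))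
      ≡⟨ ∑-comm (λ u i → ∑ (λ v → at (a i) u v ⟦ colorIs u v ⟧)) ⟩
    ∑ (λ i → ∑ (λ u → ∑ (λ v → at (a i) u v ⟦ colorIs u v ⟧)))
      ≡⟨ ∑-cong (λ i → ∑∑-at (a i) (λ u v → ⟦ colorIs u v ⟧)) ⟩
    ∑ (λ i → ⟦ isColor (col (proj₁ (a i)) (proj₂ (a i))) c ⟧) ∎
    where
    open ≡-Reasoning
    colorIs : Fin n → Fin n → Bool
    colorIs u v = isColor (col u v) c

prependSlots : ∀ a {b r} → (Fin b → Fin r) → Fin (a + b) → Fin (suc r)
prependSlots zero    g x       = suc (g x)
prependSlots (suc a) g zero    = zero
prependSlots (suc a) g (suc x) = prependSlots a g x

slotColor : ∀ {r} (f : Fin r → ℕ) → Fin (∑ f) → Fin r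
slotColor {suc r} f = prependSlots (f zero) (slotColor (f ∘ suc))

slotColor-fibre : ∀ {r} (f : Fin r → ℕ) c → ∑ (λ j → ⟦ does (slotColor f j ≟ c) ⟧) ≡ f c
slotColor-fibre {suc r} f zero    = zero-fibre (f zero) (slotColor (f ∘ suc))
  where
  zero-fibre : ∀ a {b} (g : Fin b → Fin r) → ∑ (λ x → ⟦ does (prependSlots a g x ≟ zero) ⟧) ≡ a
  zero-fibre zero    {b} g = ∑-zero b
  zero-fibre (suc a)     g = cong suc (zero-fibre a g)
slotColor-fibre {suc r} f (suc c) = trans (suc-fibre (f zero) (slotColor (f ∘ suc))) (slotColor-fibre (f ∘ suc) c)
  where
  suc-fibre : ∀ a {b} (g : Fin b → Fin r) → ∑ (λ x → ⟦ does (prependSlots a g x ≟ suc c) ⟧) ≡ ∑ (λ x → ⟦ does (g x ≟ c) ⟧)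
  suc-fibre zero    g = refl
  suc-fibre (suc a) g = suc-fibre a g

∑-slots : ∀ {r} (f : Fin r → ℕ) (S : Fin r → Bool) → ∑ (λ j → ⟦ S (slotColor f j) ⟧) ≡ ∑in S f
∑-slots {r} f S = begin
  ∑ (λ j → ⟦ S (slotColor f j) ⟧)                                     ≡⟨ ∑-cong (λ j → ∑-select (slotColor f j) (λ c → ⟦ S c ⟧)) ⟨
  ∑ (λ j → ∑ (λ c → if does (slotColor f j ≟ c) then ⟦ S c ⟧ else 0)) ≡⟨ ∑-comm (λ j c → if does (slotColor f j ≟ c) then ⟦ S c ⟧ else 0) ⟩
  ∑ (λ c → ∑ (λ j → if does (slotColor f j ≟ c) then ⟦ S c ⟧ else 0)) ≡⟨ ∑-cong fibre ⟩
  ∑in S f                                                              ∎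
  where
  open ≡-Reasoning
  fibre : ∀ c → ∑ (λ j → if does (slotColor f j ≟ c) then ⟦ S c ⟧ else 0) ≡ (if S c then f c else 0)
  fibre c with S c
  ... | true  = slotColor-fibre f c
  ... | false = trans (∑-cong (λ j → if-same (does (slotColor f j ≟ c)))) (∑-zero (∑ f))
    where
    if-same : ∀ b → (if b then 0 else 0) ≡ 0
    if-same true  = refl
    if-same false = refl

module _ {n r : ℕ} (G : Graph n) (col : Coloring n r) (col-sym : ∀ u v → col u v ≡ col v u) where

  colorClass : Fin r → Fin n → Fin n → Bool
  colorClass c u v = lt u v ∧ (adj G u v ∧ isColor (col u v) c)

  colorClass⁻ : ∀ {c u v} → (u , v) ∈ edgesOf (colorClass c) → toℕ u < toℕ v × adj G u v ≡ true × col u v ≡ c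
  colorClass⁻ {c} {u} {v} e∈ with ∧-true⁻ {lt u v} (∈-edgesOf⁻ (colorClass c) e∈)
  ... | lt≡ , rest with ∧-true⁻ {adj G u v} rest
  ...   | adj≡ , color≡ = lt-sound lt≡ , adj≡ , does-≟-sound (trans (sym (isColor≡does (col u v) c)) color≡)

  color-self : ∀ (c : Fin r) → isColor c c ≡ true
  color-self c = trans (isColor≡does c c) (does-≟-refl c)

  colorClass⁺ : ∀ {u v} → adj G u v ≡ true → (u , v) ∈± edgesOf (colorClass (col u v))
  colorClass⁺ {u} {v} adj≡ with <-cmp (toℕ u) (toℕ v)
  ... | tri< u<v _ _ = inj₁ (∈-edgesOf⁺ (colorClass (col u v))
                         (∧-true⁺ (lt-complete u<v) (∧-true⁺ adj≡ (color-self (col u v)))))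
  ... | tri≈ _ u≡v _ with trans (sym adj≡) (subst (λ w → adj G u w ≡ false) (toℕ-injective u≡v) (Graph.irrefl G u))
  ...   | ()
  colorClass⁺ {u} {v} adj≡ | tri> _ _ v<u = inj₂ (∈-edgesOf⁺ (colorClass (col u v))
                         (∧-true⁺ (lt-complete v<u) (∧-true⁺ (trans (Graph.sym G v u) adj≡)
                                                              (subst (λ c → isColor c (col u v) ≡ true) (col-sym u v) (color-self (col u v))))))


  module ColoredForest (m : ℕ) (f : Fin r → ℕ) (∑f+m≡n : ∑ f + m ≡ n)
           (bound : ∀ R → ω≤ (removeColors G col R) (m + ∑in R f)) where

    open Rado (discrete {n})

    slotClasses : Fin (∑ f) → List (Edge n)
    slotClasses j = edgesOf (colorClass (slotColor f j))

    colorsOf : (Fin (∑ f) → Bool) → Fin r → Bool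
    colorsOf I c = does (any? (λ j → (I j ≟ᵇ true) ×-dec (slotColor f j ≟ c)))

    colorsOf⁺ : ∀ I {j} → I j ≡ true → colorsOf I (slotColor f j) ≡ true
    colorsOf⁺ I {j} Ij with any? (λ j′ → (I j′ ≟ᵇ true) ×-dec (slotColor f j′ ≟ slotColor f j))
    ... | yes _ = refl
    ... | no ∄  = ⊥-elim (∄ (j , Ij , refl))

    colorsOf⁻ : ∀ I {c} → colorsOf I c ≡ true → ∃ λ j → I j ≡ true × slotColor f j ≡ c
    colorsOf⁻ I {c} _ with any? (λ j → (I j ≟ᵇ true) ×-dec (slotColor f j ≟ c))
    ... | yes found = found

    -- The slots in I span exactly the edges of the colors they use, and those form
    -- G − E_R(G) for R the set of unused colors.
    slotClasses-rado : RadoCondition slotClasses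
    slotClasses-rado I = begin
      ∣ I ∣ + size (joinAll discrete (⋃ slotClasses I))
        ≤⟨ +-mono-≤ (≤-trans (∑-mono-≤ slot-used) (≤-reflexive (∑-slots f used))) (bound unused _ components) ⟩
      ∑in used f + (m + ∑in unused f)  ≡⟨ rearrange (∑in used f) m (∑in unused f) ⟩
      ∑in used f + ∑in unused f + m    ≡⟨ cong (_+ m) (∑in-complement used f) ⟩
      ∑ f + m                          ≡⟨ ∑f+m≡n ⟩
      n                                ∎
      where
      open ≤-Reasoning
      used unused : Fin r → Bool
      used = colorsOf I
      unused = not ∘ used
      slot-used : ∀ j → ⟦ I j ⟧ ≤ ⟦ used (slotColor f j) ⟧
      slot-used j with I j in Ij
      ... | false = z≤n
      ... | true rewrite colorsOf⁺ I Ij = ≤-refl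
      inside : ∀ {u v} → (u , v) ∈ ⋃ slotClasses I → removeColors G col unused u v ≡ true
      inside e∈ with ∈-⋃⁻ slotClasses I e∈
      ... | j , Ij , e∈j with colorClass⁻ e∈j
      ...   | _ , adj≡ , color≡ =
              ∧-true⁺ adj≡ (trans (not-involutive _) (subst (λ c → used c ≡ true) (sym color≡) (colorsOf⁺ I Ij)))
      covers : ∀ {u v} → removeColors G col unused u v ≡ true → (u , v) ∈± ⋃ slotClasses I
      covers {u} {v} e with ∧-true⁻ {adj G u v} e
      ... | adj≡ , kept with colorsOf⁻ I (trans (sym (not-involutive _)) kept)
      ...   | j , Ij , φj≡ with colorClass⁺ adj≡
      ...     | inj₁ e∈ = inj₁ (∈-⋃⁺ slotClasses I j Ij (subst (λ c → _ ∈ edgesOf (colorClass c)) (sym φj≡) e∈))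
      ...     | inj₂ e∈ = inj₂ (∈-⋃⁺ slotClasses I j Ij (subst (λ c → _ ∈ edgesOf (colorClass c)) (sym φj≡) e∈))
      components : HasComponents (removeColors G col unused) (size (joinAll discrete (⋃ slotClasses I)))
      components = edges⇒components _ _ (removeColors-sym G col col-sym unused) inside covers
      rearrange : ∀ a b c → a + (b + c) ≡ a + c + b
      rearrange = solve-∀

    -- Opaque, so that unification never tries to run Rado's algorithm.
    opaque
      transversal : IndependentTransversal slotClasses
      transversal = rado slotClasses slotClasses-rado

    forestEdge : Fin (∑ f) → Edge n
    forestEdge = proj₁ transversal

    forestEdge∈slotClass : ∀ i → forestEdge i ∈ slotClasses i
    forestEdge∈slotClass = proj₁ (proj₂ transversal)

    edges-independent : merges discrete (edgeList forestEdge) ≡ ∑ f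
    edges-independent = proj₂ (proj₂ transversal)

    forestEdge-oriented : ∀ i → toℕ (proj₁ (forestEdge i)) < toℕ (proj₂ (forestEdge i))
    forestEdge-oriented i = proj₁ (colorClass⁻ (forestEdge∈slotClass i))

    forest : Graph n
    forest = edgeGraph (edgeList forestEdge) (oriented-edgeList forestEdge forestEdge-oriented)

    forestEdges⊆G : ∀ {u v} → (u , v) ∈ edgeList forestEdge → adj G u v ≡ true
    forestEdges⊆G e∈ with ∈-edgeList⁻ forestEdge e∈
    ... | i , refl = proj₁ (proj₂ (colorClass⁻ (forestEdge∈slotClass i)))

    forest⊆G : SpanningSubgraph forest G
    forest⊆G u v uv∈F with edgeAdj⁻ {L = edgeList forestEdge} uv∈F
    ... | inj₁ uv∈ = forestEdges⊆G uv∈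
    ... | inj₂ vu∈ = trans (Graph.sym G u v) (forestEdges⊆G vu∈)

    forest-acyclic : Forest forest
    forest-acyclic = independent⇒acyclic (edgeList forestEdge) (trans edges-independent (sym (length-edgeList forestEdge)))

    forest-components : HasComponents (adj forest) m
    forest-components = subst (HasComponents (edgeAdj L)) size≡m
                          (edges⇒components (edgeAdj L) L (edgeAdj-sym L) (edgeAdj⁺ ∘ inj₁) edgeAdj⁻)
      where
      L = edgeList forestEdge
      size≡m : size (joinAll discrete L) ≡ m
      size≡m = +-cancelˡ-≡ (∑ f) _ _ (begin
        ∑ f + size (joinAll discrete L)               ≡⟨ cong (_+ size (joinAll discrete L)) edges-independent ⟨
        merges discrete L + size (joinAll discrete L) ≡⟨ size-joinAll discrete L ⟨
        n                                             ≡⟨ ∑f+m≡n ⟨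
        ∑ f + m                                       ∎)
        where open ≡-Reasoning

    forest-colorCount : ∀ c → colorCount forest col c ≡ f c
    forest-colorCount c = begin
      colorCount forest col c
        ≡⟨ colorCount-edgeGraph col forestEdge (independent-injective forestEdge edges-independent) forestEdge-oriented c ⟩
      ∑ (λ i → ⟦ isColor (col (proj₁ (forestEdge i)) (proj₂ (forestEdge i))) c ⟧)
        ≡⟨ ∑-cong (λ i → cong (λ d → ⟦ isColor d c ⟧) (proj₂ (proj₂ (colorClass⁻ (forestEdge∈slotClass i))))) ⟩
      ∑ (λ i → ⟦ isColor (slotColor f i) c ⟧)
        ≡⟨ ∑-cong (λ i → cong ⟦_⟧ (isColor≡does (slotColor f i) c)) ⟩
      ∑ (λ i → ⟦ does (slotColor f i ≟ c) ⟧)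
        ≡⟨ slotColor-fibre f c ⟩
      f c ∎
      where open ≡-Reasoning

corollary1 : ∀ {n r : ℕ} (m : ℕ) (f : Fin r → ℕ) (G : Graph n) (col : Coloring n r)
    → (∀ u v → col u v ≡ col v u)
    → ∑ f + m ≡ n
    → (Σ (Graph n) λ F → SpanningSubgraph F G × Forest F × HasComponents (adj F) m
         × (∀ c → colorCount F col c ≡ f c))
      ⇔ (∀ (R : Fin r → Bool) → ω≤ (removeColors G col R) (m + ∑in R f))
corollary1 m f G col col-sym ∑f+m≡n = mk⇔
  (λ (F , F⊆G , F-acyclic , _ , counts) → forest⇒component-bound col m f G col-sym ∑f+m≡n F F⊆G F-acyclic counts)
  (λ bound → let open ColoredForest G col col-sym m f ∑f+m≡n bound in
     forest , forest⊆G , forest-acyclic , forest-components , forest-colorCount)
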